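{- Let $H$ be a graph on $k$ vertices, let $V(K_n)=A\cup B$ be a balanced partition, let $\mathcal{H}=\mathcal{H}(A,B,H)$ be the hypergraph defined below, and let $\tau=n^{ -1/\max\{m_2(H),1\}}$. For each $1\le j\le e(H)$, the maximum $j$-degree of $\mathcal{H}$ satisfies \[\Delta_j(\mathcal{H})\le e(H)!\cdot\tau^{j-1}n^{k-2}.\]
   Context: For a graph $H$ with at least two edges, $m_2(H)=\max\{(e(F)-1)/(v(F)-2) : F\subseteq H,\ v(F)\ge 3\}$; otherwise $m_2(H)=1/2$. $\alpha(H)$ is the independence number of $H$; a balanced partition has $|A|=|B|$. Let $\Gamma$ be the set of all $2$-colourings $\chi\colon E(K_n)\to\{b,r\}$ ($b$ = blue, $r$ = red). Given $\chi$, an $(A,B)$-good copy of $H$ in $\chi$ is a subgraph $L\subset K_n$ isomorphic to $H$ such that either all edges of $L$ are red under $\chi$ and $|V(L)\cap A|\ge\alpha(H)$, or all edges are blue and $|V(L)\cap B|\ge\alpha(H)$. For $F\subset K_n$ write $F_\chi=\{(e,\chi(e)) : e\in E(F)\}$. The $e(H)$-uniform hypergraph $\mathcal{H}$ has vertex set $E(K_n)\times\{b,r\}$ and edge set $\{L_\chi : \chi\in\Gamma,\ L \text{ an } (A,B)\text{ -good copy of } H \text{ in } \chi\}$. The maximum $j$-degree $\Delta_j(\mathcal{H})$ is the maximum, over all $j$-element sets $U\subset V(\mathcal{H})$, of the number of edges of $\mathcal{H}$ containing $U$. -}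

module Defs where

open import Data.Nat using (ℕ; zero; suc; _+_; _*_; _∸_; _^_; _≤_; _<_; _≥_; _<ᵇ_; _!)
open import Data.Bool using (Bool; true; false; if_then_else_; _∧_; not)
open import Data.Fin using (Fin; toℕ)
open import Data.List using (List; []; _∷_; allFin; map; length)
open import Data.Nat.ListAction using (sum)
open import Data.List.Relation.Unary.All using (All)
open import Data.List.Relation.Unary.AllPairs using (AllPairs)
open import Data.Product using (Σ; ∃; _×_; _,_)
open import Data.Sum using (_⊎_)
open import Relation.Binary.PropositionalEquality using (_≡_; _≢_)
open import Relation.Nullary using (¬_)
open import Function.Bundles using (_⇔_)

record Graph (k : ℕ) : Set where
  field
    adj   : Fin k → Fin k → Bool
    sym   : ∀ a b → adj a b ≡ adj b a
    irrefl : ∀ a → adj a a ≡ false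
open Graph public

count : ∀ {k} → (Fin k → Bool) → ℕ
count {k} P = sum (map (λ a → if P a then 1 else 0) (allFin k))

countPairs : ∀ {k} → (Fin k → Fin k → Bool) → ℕ
countPairs {k} P = sum (map (λ a → count (λ b → (toℕ a <ᵇ toℕ b) ∧ P a b)) (allFin k))

eH : ∀ {k} → Graph k → ℕ
eH H = countPairs (adj H)

allVecs : (k : ℕ) → List (Fin k → Bool)
allVecs zero = (λ ()) ∷ []
allVecs (suc k) = go (allVecs k)
  where
  ext : Bool → (Fin k → Bool) → Fin (suc k) → Bool
  ext x S Fin.zero = x
  ext x S (Fin.suc i) = S i
  go : List (Fin k → Bool) → List (Fin (suc k) → Bool)
  go [] = []
  go (S ∷ Ss) = ext false S ∷ ext true S ∷ go Ss

maxL : List ℕ → ℕ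
maxL [] = 0
maxL (x ∷ xs) = Data.Nat._⊔_ x (maxL xs)

independent : ∀ {k} → Graph k → (Fin k → Bool) → Bool
independent H S = countPairs (λ a b → S a ∧ S b ∧ adj H a b) Data.Nat.≡ᵇ 0

α : ∀ {k} → Graph k → ℕ
α {k} H = maxL (map (λ S → if independent H S then count S else 0) (allVecs k))

record Subgraph {k} (H : Graph k) : Set where
  field
    vs : Fin k → Bool
    es : Fin k → Fin k → Bool
    es-sub : ∀ a b → es a b ≡ true → (adj H a b ≡ true) × (vs a ≡ true) × (vs b ≡ true)
open Subgraph public

vF : ∀ {k} {H : Graph k} → Subgraph H → ℕ
vF F = count (vs F)

eF : ∀ {k} {H : Graph k} → Subgraph H → ℕ
eF F = countPairs (λ a b → es F a b ∨' es F b a)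
  where
  _∨'_ : Bool → Bool → Bool
  true ∨' _ = true
  false ∨' y = y

-- p / q (with q ≥ 1) equals max{ m₂(H) , 1 }.
-- m₂(H) = max{(e(F)-1)/(v(F)-2) : F ⊆ H, v(F) ≥ 3} if e(H) ≥ 2, and 1/2 otherwise;
-- in the latter case max{m₂(H),1} = 1, which the characterisation below also yields.
IsMaxM2One : ∀ {k} → Graph k → ℕ → ℕ → Set
IsMaxM2One H p q =
  (1 ≤ q) × (q ≤ p) ×
  (∀ (F : Subgraph H) → 3 ≤ vF F → (eF F ∸ 1) * q ≤ p * (vF F ∸ 2)) ×
  ((p ≡ q) ⊎ (Σ (Subgraph H) λ F → (3 ≤ vF F) × (1 ≤ eF F) × ((eF F ∸ 1) * q ≡ p * (vF F ∸ 2))))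

data Colour : Set where
  blue red : Colour

-- vertices of ℋ : E(K_n) × {b,r}; an edge of K_n is a pair u < v
record VElt (n : ℕ) : Set where
  constructor velt
  field
    u : Fin n
    v : Fin n
    u<v : toℕ u < toℕ v
    col : Colour
open VElt public

-- a 2-colouring χ of E(K_n); the colour of the edge {x,y} with x < y is χ x y
Colouring : ℕ → Set
Colouring n = Fin n → Fin n → Colour

colourOf : ∀ {n} → Colouring n → Fin n → Fin n → Colour
colourOf χ x y = if toℕ x <ᵇ toℕ y then χ x y else χ y x

record Copy {k} (n : ℕ) (H : Graph k) : Set where
  field
    f : Fin k → Fin n
    inj : ∀ a b → f a ≡ f b → a ≡ b
open Copy public

InL : ∀ {k n} {H : Graph k} → Copy n H → Fin n → Fin n → Set
InL {H = H} L x y = Σ (Fin _) λ a → Σ (Fin _) λ b → (adj H a b ≡ true) × (f L a ≡ x) × (f L b ≡ y)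

Mono : ∀ {k n} {H : Graph k} → Colouring n → Copy n H → Colour → Set
Mono {H = H} χ L c = ∀ a b → adj H a b ≡ true → colourOf χ (f L a) (f L b) ≡ c

-- (A,B)-good copy; A is given by its indicator (true = A, false = B)
Good : ∀ {k n} (H : Graph k) → (Fin n → Bool) → Colouring n → Copy n H → Set
Good H A χ L =
  (Mono χ L red  × (α H ≤ count (λ a → A (f L a)))) ⊎
  (Mono χ L blue × (α H ≤ count (λ a → not (A (f L a)))))

VSet : ℕ → Set
VSet n = VElt n → Bool

IsHyperedge : ∀ {k n} (H : Graph k) → (Fin n → Bool) → VSet n → Set
IsHyperedge {n = n} H A S =
  Σ (Colouring n) λ χ → Σ (Copy n H) λ L → Good H A χ L ×
    (∀ (x : VElt n) → (S x ≡ true) ⇔ (InL L (u x) (v x) × (col x ≡ colourOf χ (u x) (v x))))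

DistinctV : ∀ {n} → VElt n → VElt n → Set
DistinctV x y = ¬ ((u x ≡ u y) × (v x ≡ v y) × (col x ≡ col y))

DistinctS : ∀ {n} → VSet n → VSet n → Set
DistinctS S T = Σ (VElt _) λ x → S x ≢ T x

IsJSet : ∀ {n} → ℕ → List (VElt n) → Set
IsJSet j U = (length U ≡ j) × AllPairs DistinctV U

VertexSubset : ℕ → Set
VertexSubset n = Fin n → Bool

-- Δ_j(ℋ) ≤ D expressed through families: every family of distinct hyperedges
-- containing a common j-set has size m with  m^p · n^((j-1)q) ≤ (e(H)! · n^(k-2))^p

-- Let τ = n^(-q/p). A hyperedge containing the j-set U is the edge set of a
-- monochromatic copy L of H, coloured like U, that contains the j edges of U;
-- so it suffices to count these edge sets, or the embeddings f : V(H) → V(K_n)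
-- producing them. Group the embeddings by which edge of H lands on each edge of
-- U: there are at most e(H)!/(e(H)-j)! groups. Inside a group f is determined by
-- its values off f⁻¹(V(U)) (at most n choices each) and by one orientation bit
-- per edge of U that meets no other edge of U (an isolated edge); on every other
-- edge of U the orientation is forced by a neighbouring edge. The edges of U that
-- are not isolated come from a subgraph F of H with v(F) ≥ 3, and the density
-- bound (e(F) - 1) q ≤ p (v(F) - 2) saves the factor τ^(e(F)-1); each isolated
-- edge saves τ against one of its two vertices and pays for its bit with the
-- other. When every edge of U is isolated the bits are paid by 2^c ≤ n^(c-1)
-- (j ≥ 2) or by 2 e(H) ≤ e(H)! (j = 1, e(H) ≥ 3). For j = 1 and e(H) ≤ 2
-- embeddings overcount, and the edge sets are counted directly: such an edge set
-- is determined by its edge other than the one in U.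
module Submission where

open import Defs hiding (sym)
open import Data.Nat as ℕ using (ℕ; zero; suc; _+_; _*_; _∸_; _^_; _≤_; _<_; z≤n; s≤s; _<ᵇ_; _!)
open import Data.Nat.Base using (>-nonZero)
open import Data.Nat.Properties hiding (_≟_; _<?_)
open import Data.Nat.ListAction using (sum; product)
open import Data.Nat.Solver using (module +-*-Solver)
open import Data.Bool using (Bool; true; false; not; if_then_else_; _∧_)
import Data.Bool.Properties as Bool
open import Data.Fin using (Fin; zero; suc; toℕ; _≟_; _<?_)
import Data.Fin.Properties as Fin
open import Data.List
  using (List; []; _∷_; map; length; filter; tabulate; head; allFin; concatMap; _++_; deduplicate; cartesianProduct)
import Data.List.Properties as List
open import Data.List.Properties
  using (filter-notAll; length-map; length-++; length-tabulate; ∷-injective; tabulate-cong; map-tabulate; map-id)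
open import Data.List.Extrema.Nat using (argmax; f[⊥]≤f[argmax]; f[xs]≤f[argmax])
open import Data.List.Membership.Propositional using (_∈_; find; lose)
open import Data.List.Membership.Propositional.Properties
  using ( ∈-filter⁺; ∈-filter⁻; ∈-map⁺; ∈-map⁻; ∈-allFin; ∈-concatMap⁺; ∈-concatMap⁻
        ; ∈-deduplicate⁺; ∈-deduplicate⁻; ∈-++⁺ˡ; ∈-++⁺ʳ; ∈-cartesianProduct⁺)
open import Data.List.Relation.Unary.All as All using (All; []; _∷_)
open import Data.List.Relation.Unary.All.Properties using (¬All⇒Any¬)
import Data.List.Relation.Unary.All.Properties as All
open import Data.List.Relation.Unary.Any as Any using (here; there; any?)
open import Data.List.Relation.Unary.AllPairs as AP using (AllPairs; []; _∷_)
import Data.List.Relation.Unary.AllPairs.Properties as AllPairs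
open import Data.List.Relation.Unary.Unique.Propositional using (Unique)
open import Data.List.Relation.Unary.Unique.DecPropositional.Properties using (deduplicate-!)
import Data.List.Relation.Binary.Sublist.Propositional.Properties as Sublist
open import Data.Maybe using (just)
import Data.Maybe.Properties as Maybe
open import Data.Product using (Σ; ∃; _×_; _,_; proj₁; proj₂; uncurry)
import Data.Product.Properties as Product
open import Data.Sum using (_⊎_; inj₁; inj₂; swap; [_,_]′)
open import Data.Sum.Properties using (inj₁-injective; inj₂-injective)
import Data.Sum.Properties as Sum
import Data.Vec as Vec
open import Data.Empty using (⊥-elim)
open import Function using (_∘_; id; case_of_)
open import Function.Bundles using (Equivalence; mk⇔; _⇔_)
open import Relation.Binary.Definitions using (DecidableEquality)
open import Relation.Binary.PropositionalEquality
  using (_≡_; _≢_; _≗_; refl; sym; trans; cong; cong₂; subst; subst₂; module ≡-Reasoning)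
open import Relation.Nullary using (¬_; Dec; yes; no; ¬?; ⌊_⌋; contradiction)
open import Relation.Nullary.Decidable using (_⊎-dec_; decidable-stable)
open import Relation.Unary using (Decidable)

open +-*-Solver

module _ {A : Set} (_≟_ : DecidableEquality A) where

  unique-⊆⇒length≤ : ∀ {xs ys : List A} → Unique ys → (∀ {y} → y ∈ ys → y ∈ xs) → length ys ≤ length xs
  unique-⊆⇒length≤ {ys = []} _ _ = z≤n
  unique-⊆⇒length≤ {xs} {y ∷ ys} (y∉ys ∷ ys!) ys⊆xs = ≤-trans
      (s≤s (unique-⊆⇒length≤ ys! (λ z∈ys → ∈-filter⁺ ≢y? (ys⊆xs (there z∈ys)) (All.lookup y∉ys z∈ys))))
      (filter-notAll ≢y? xs (Any.map (λ y≡x y≢x → y≢x y≡x) (ys⊆xs (here refl))))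
    where
    ≢y? = λ x → ¬? (y ≟ x)

length-filter-complement : ∀ {A : Set} {P : A → Set} (P? : Decidable P) xs →
  length (filter P? xs) + length (filter (λ x → ¬? (P? x)) xs) ≡ length xs
length-filter-complement P? [] = refl
length-filter-complement P? (x ∷ xs) with P? x
... | yes _ = cong suc (length-filter-complement P? xs)
... | no _ = trans (+-suc _ _) (cong suc (length-filter-complement P? xs))

module _ {A C : Set} (_≟_ : DecidableEquality C) (κ : A → C) where

  fibre : C → List A → List A
  fibre c = filter (λ x → κ x ≟ c)

  length≤fibres : ∀ B (cs : List C) (xs : List A) → (∀ {x} → x ∈ xs → κ x ∈ cs) →
    (∀ {c} → c ∈ cs → length (fibre c xs) ≤ B) → length xs ≤ length cs * B
  length≤fibres B [] [] _ _ = z≤n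
  length≤fibres B [] (x ∷ xs) κ∈ _ with κ∈ (here refl)
  ... | ()
  length≤fibres B (c ∷ cs) xs κ∈ fibre≤ = begin
      length xs                           ≡⟨ length-filter-complement (λ x → κ x ≟ c) xs ⟨
      length (fibre c xs) + length rest   ≤⟨ +-mono-≤ (fibre≤ (here refl)) (length≤fibres B cs rest rest∈ rest≤) ⟩
      B + length cs * B                   ∎
    where
    open ≤-Reasoning
    ≢c? = λ x → ¬? (κ x ≟ c)
    rest = filter ≢c? xs
    rest∈ : ∀ {x} → x ∈ rest → κ x ∈ cs
    rest∈ x∈ with ∈-filter⁻ ≢c? x∈
    ... | x∈xs , κx≢c with κ∈ x∈xs
    ...   | here κx≡c = ⊥-elim (κx≢c κx≡c)
    ...   | there κx∈cs = κx∈cs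
    rest≤ : ∀ {c′} → c′ ∈ cs → length (fibre c′ rest) ≤ B
    rest≤ {c′} c′∈ = ≤-trans
      (Sublist.length-mono-≤ (Sublist.filter⁺ ≡c′? ≡c′? (λ { refl p → p }) (Sublist.filter-⊆ ≢c? xs)))
      (fibre≤ (there c′∈))
      where ≡c′? = λ x → κ x ≟ c′

  largest-fibre : ∀ (cs : List C) x xs → (∀ {y} → y ∈ x ∷ xs → κ y ∈ cs) →
    ∃ λ y → length (x ∷ xs) ≤ length cs * length (fibre (κ y) (x ∷ xs))
  largest-fibre cs x xs κ∈ = y* , length≤fibres _ cs ys κ∈ fibre≤
    where
    ys = x ∷ xs
    size : A → ℕ
    size y = length (fibre (κ y) ys)
    y* = argmax size x xs
    maximal : ∀ {y} → y ∈ ys → size y ≤ size y*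
    maximal (here refl) = f[⊥]≤f[argmax] {f = size} x xs
    maximal (there y∈xs) = All.lookup (f[xs]≤f[argmax] {f = size} x xs) y∈xs
    fibre≤ : ∀ {c} → c ∈ cs → length (fibre c ys) ≤ size y*
    fibre≤ {c} _ with fibre c ys in eq
    ... | [] = z≤n
    ... | y ∷ _ with ∈-filter⁻ (λ x → κ x ≟ c) {xs = ys} (subst (y ∈_) (sym eq) (here refl))
    ...   | y∈ys , refl = subst (λ zs → length zs ≤ size y*) eq (maximal y∈ys)

AllPairs-map-on : ∀ {A B : Set} {P : A → Set} {R : A → A → Set} {S : B → B → Set} (f : A → B) →
  (∀ {x y} → P x → P y → R x y → S (f x) (f y)) → ∀ {xs} → All P xs → AllPairs R xs → AllPairs S (map f xs)
AllPairs-map-on f pres [] [] = []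
AllPairs-map-on {P = P} {R} {S} f pres {x ∷ xs} (px ∷ pxs) (rx ∷ rxs) =
  heads pxs rx ∷ AllPairs-map-on f pres pxs rxs
  where
  heads : ∀ {ys} → All P ys → All (R x) ys → All (S (f x)) (map f ys)
  heads [] [] = []
  heads (py ∷ pys) (r ∷ rs) = pres px py r ∷ heads pys rs

map-proj₁-toList : ∀ {A : Set} {P : A → Set} {xs} (pxs : All P xs) → map proj₁ (All.toList pxs) ≡ xs
map-proj₁-toList [] = refl
map-proj₁-toList (px ∷ pxs) = cong (_ ∷_) (map-proj₁-toList pxs)

pairwise-related⇒length≤1 : ∀ {A : Set} {R : A → A → Set} {xs} → AllPairs (λ x y → ¬ (R x y × R y x)) xs →
  (∀ {x y} → x ∈ xs → y ∈ xs → R x y) → length xs ≤ 1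
pairwise-related⇒length≤1 {xs = []} _ _ = z≤n
pairwise-related⇒length≤1 {xs = _ ∷ []} _ _ = s≤s z≤n
pairwise-related⇒length≤1 {xs = _ ∷ _ ∷ _} ((¬R ∷ _) ∷ _) R =
  ⊥-elim (¬R (R (here refl) (there (here refl)) , R (there (here refl)) (here refl)))

length-cartesianProduct : ∀ {A B : Set} (xs : List A) (ys : List B) →
  length (cartesianProduct xs ys) ≡ length xs * length ys
length-cartesianProduct [] ys = refl
length-cartesianProduct (x ∷ xs) ys =
  trans (length-++ (map (x ,_) ys)) (cong₂ _+_ (length-map (x ,_) ys) (length-cartesianProduct xs ys))

distinct-functions≤product : ∀ {Z : Set} (_≟_ : DecidableEquality Z) k (box : Fin k → List Z) (hs : List (Fin k → Z)) →
  AllPairs (λ h h′ → ¬ h ≗ h′) hs → (∀ {h} → h ∈ hs → ∀ a → h a ∈ box a) →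
  length hs ≤ product (tabulate (length ∘ box))
distinct-functions≤product _≟_ zero box [] _ _ = z≤n
distinct-functions≤product _≟_ zero box (h ∷ []) _ _ = s≤s z≤n
distinct-functions≤product _≟_ zero box (h ∷ h′ ∷ hs) ((h≉h′ ∷ _) ∷ _) _ = ⊥-elim (h≉h′ (λ ()))
distinct-functions≤product {Z} _≟_ (suc k) box hs hs! h∈box =
  length≤fibres _≟_ (λ h → h zero) _ (box zero) hs (λ h∈ → h∈box h∈ zero) fibre≤
  where
  tail : (Fin (suc k) → Z) → Fin k → Z
  tail h = h ∘ suc
  fibre≤ : ∀ {c} → c ∈ box zero →
    length (fibre _≟_ (λ h → h zero) c hs) ≤ product (tabulate (length ∘ box ∘ suc))
  fibre≤ {c} _ = subst (_≤ _) (length-map tail F)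
    (distinct-functions≤product _≟_ k (box ∘ suc) (map tail F)
      (AllPairs-map-on tail (λ hc h′c h≉h′ tails≗ → h≉h′ λ { zero → trans hc (sym h′c) ; (suc a) → tails≗ a })
        (All.tabulate (λ h∈ → proj₂ (∈-filter⁻ (λ h → h zero ≟ c) {xs = hs} h∈)))
        (AllPairs.filter⁺ (λ h → h zero ≟ c) hs!))
      tails∈box)
    where
    F = fibre _≟_ (λ h → h zero) c hs
    tails∈box : ∀ {h} → h ∈ map tail F → ∀ a → h a ∈ box (suc a)
    tails∈box h∈ a with ∈-map⁻ tail h∈
    ... | h′ , h′∈ , refl = h∈box (proj₁ (∈-filter⁻ (λ h → h zero ≟ c) h′∈)) (suc a)

falling : ℕ → ℕ → ℕ
falling m zero = 1
falling m (suc j) = m * falling (m ∸ 1) j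

falling-mono : ∀ j {m m′} → m ≤ m′ → falling m j ≤ falling m′ j
falling-mono zero _ = ≤-refl
falling-mono (suc j) m≤m′ = *-mono-≤ m≤m′ (falling-mono j (∸-monoˡ-≤ 1 m≤m′))

falling≤! : ∀ j m → falling m j ≤ m !
falling≤! zero m = 1≤n! m
falling≤! (suc j) zero = z≤n
falling≤! (suc j) (suc m) = *-monoʳ-≤ (suc m) (falling≤! j m)

module _ {A : Set} (_≟_ : DecidableEquality A) where

  unique-lists≤falling : ∀ j (es : List A) (ss : List (List A)) → Unique ss →
    (∀ {s} → s ∈ ss → Unique s × length s ≡ j × (∀ {x} → x ∈ s → x ∈ es)) →
    length ss ≤ falling (length es) j
  unique-lists≤falling zero es [] _ _ = z≤n
  unique-lists≤falling zero es (s ∷ []) _ _ = s≤s z≤n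
  unique-lists≤falling zero es (s ∷ s′ ∷ ss) ((s≢s′ ∷ _) ∷ _) ok
    with ok (here refl) | ok (there (here refl))
  ... | _ , s≡[] , _ | _ , s′≡[] , _ = ⊥-elim (s≢s′ (trans (length≡0 s≡[]) (sym (length≡0 s′≡[]))))
    where
    length≡0 : ∀ {t : List A} → length t ≡ 0 → t ≡ []
    length≡0 {[]} _ = refl
  unique-lists≤falling (suc j) es ss ss! ok =
    subst (λ m → length ss ≤ m * falling (length es ∸ 1) j) (length-map just es)
      (length≤fibres (Maybe.≡-dec _≟_) head _ (map just es) ss head∈ fibre≤)
    where
    head∈ : ∀ {s} → s ∈ ss → head s ∈ map just es
    head∈ s∈ with ok s∈
    head∈ {x ∷ s} s∈ | _ , _ , s⊆es = ∈-map⁺ just (s⊆es (here refl))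
    fibre≤ : ∀ {c} → c ∈ map just es → length (fibre (Maybe.≡-dec _≟_) head c ss) ≤ falling (length es ∸ 1) j
    fibre≤ {c} c∈ with ∈-map⁻ just c∈
    ... | x , x∈es , refl = begin
        length F                  ≡⟨ length-map tail′ F ⟨
        length (map tail′ F)      ≤⟨ unique-lists≤falling j es′ (map tail′ F) tails! tails-ok ⟩
        falling (length es′) j    ≤⟨ falling-mono j (<⇒≤pred (filter-notAll ≢x? es x∈es′)) ⟩
        falling (length es ∸ 1) j ∎
      where
      open ≤-Reasoning
      head≡x? = λ s → Maybe.≡-dec _≟_ (head s) (just x)
      ≢x? = λ y → ¬? (x ≟ y)
      F = fibre (Maybe.≡-dec _≟_) head (just x) ss
      es′ = filter ≢x? es
      tail′ : List A → List A
      tail′ [] = []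
      tail′ (_ ∷ t) = t
      x∈es′ = Any.map (λ x≡y x≢y → x≢y x≡y) x∈es
      same-head : ∀ {s s′} → head s ≡ just x → head s′ ≡ just x → tail′ s ≡ tail′ s′ → s ≡ s′
      same-head {_ ∷ _} {_ ∷ _} refl refl refl = refl
      tails! : Unique (map tail′ F)
      tails! = AllPairs-map-on tail′ (λ hs hs′ s≢s′ t≡t′ → s≢s′ (same-head hs hs′ t≡t′))
                 (All.tabulate (λ s∈ → proj₂ (∈-filter⁻ head≡x? {xs = ss} s∈))) (AllPairs.filter⁺ head≡x? ss!)
      tails-ok : ∀ {t} → t ∈ map tail′ F → Unique t × length t ≡ j × (∀ {y} → y ∈ t → y ∈ es′)
      tails-ok t∈ with ∈-map⁻ tail′ t∈
      ... | s , s∈F , refl with ∈-filter⁻ head≡x? s∈F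
      ...   | s∈ , hs with s | ok s∈ | hs
      ...     | .x ∷ t | x∉t ∷ t! , refl , s⊆es | refl =
                t! , refl , λ y∈t → ∈-filter⁺ ≢x? (s⊆es (there y∈t)) (All.lookup x∉t y∈t)

indicator-sum≡length-filter : ∀ {A : Set} (P : A → Bool) xs →
  sum (map (λ x → if P x then 1 else 0) xs) ≡ length (filter (λ x → P x Bool.≟ true) xs)
indicator-sum≡length-filter P [] = refl
indicator-sum≡length-filter P (x ∷ xs) with P x
... | true = cong suc (indicator-sum≡length-filter P xs)
... | false = indicator-sum≡length-filter P xs

unique⇒length≤count : ∀ {k} (P : Fin k → Bool) {ys} → Unique ys → All (λ y → P y ≡ true) ys → length ys ≤ count P
unique⇒length≤count {k} P ys! Pys = subst (_ ≤_) (sym (indicator-sum≡length-filter P (allFin k)))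
  (unique-⊆⇒length≤ _≟_ ys! (λ y∈ → ∈-filter⁺ (λ x → P x Bool.≟ true) (∈-allFin _) (All.lookup Pys y∈)))

partnersAbove : ∀ {k} → (Fin k → Fin k → Bool) → Fin k → List (Fin k)
partnersAbove {k} P a = filter (λ b → ((toℕ a <ᵇ toℕ b) ∧ P a b) Bool.≟ true) (allFin k)

pairsWith : ∀ {k} → (Fin k → Fin k → Bool) → List (Fin k × Fin k)
pairsWith {k} P = concatMap (λ a → map (a ,_) (partnersAbove P a)) (allFin k)

length-pairsWith : ∀ {k} (P : Fin k → Fin k → Bool) → length (pairsWith P) ≡ countPairs P
length-pairsWith {k} P = go (allFin k)
  where
  go : ∀ as → length (concatMap (λ a → map (a ,_) (partnersAbove P a)) as)
            ≡ sum (map (λ a → count (λ b → (toℕ a <ᵇ toℕ b) ∧ P a b)) as)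
  go [] = refl
  go (a ∷ as) = trans (length-++ (map (a ,_) (partnersAbove P a)))
    (cong₂ _+_ (trans (length-map (a ,_) (partnersAbove P a))
                      (sym (indicator-sum≡length-filter (λ b → (toℕ a <ᵇ toℕ b) ∧ P a b) (allFin k))))
               (go as))

∈-pairsWith⁺ : ∀ {k} {P : Fin k → Fin k → Bool} {a b} → toℕ a < toℕ b → P a b ≡ true → (a , b) ∈ pairsWith P
∈-pairsWith⁺ {k} {P} {a} {b} a<b Pab = ∈-concatMap⁺ (λ a → map (a ,_) (partnersAbove P a))
  (Any.map (λ { refl → ∈-map⁺ (a ,_) (∈-filter⁺ (λ b → ((toℕ a <ᵇ toℕ b) ∧ P a b) Bool.≟ true) (∈-allFin b) ab-ok) })
    (∈-allFin a))
  where
  ab-ok : ((toℕ a <ᵇ toℕ b) ∧ P a b) ≡ true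
  ab-ok rewrite Equivalence.to Bool.T-≡ (<⇒<ᵇ a<b) | Pab = refl

∈-pairsWith⁻ : ∀ {k} {P : Fin k → Fin k → Bool} {a b} → (a , b) ∈ pairsWith P → toℕ a < toℕ b × P a b ≡ true
∈-pairsWith⁻ {k} {P} {a} {b} ab∈
  with Any.satisfied (∈-concatMap⁻ (λ a → map (a ,_) (partnersAbove P a)) {xs = allFin k} ab∈)
... | a′ , ab∈row with ∈-map⁻ (a′ ,_) ab∈row
...   | b′ , b′∈ , refl with proj₂ (∈-filter⁻ (λ b → ((toℕ a <ᵇ toℕ b) ∧ P a b) Bool.≟ true) {xs = allFin k} b′∈)
...     | ok with (toℕ a <ᵇ toℕ b) in a<ᵇb
...       | true = <ᵇ⇒< (toℕ a) (toℕ b) (Equivalence.from Bool.T-≡ a<ᵇb) , ok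

unique⇒length≤countPairs : ∀ {k} (P : Fin k → Fin k → Bool) {ps} → Unique ps →
  All (λ p → toℕ (proj₁ p) < toℕ (proj₂ p) × P (proj₁ p) (proj₂ p) ≡ true) ps → length ps ≤ countPairs P
unique⇒length≤countPairs P ps! ok = subst (_ ≤_) (length-pairsWith P)
  (unique-⊆⇒length≤ (Product.≡-dec _≟_ _≟_) ps! (λ p∈ → let a<b , Pab = All.lookup ok p∈ in ∈-pairsWith⁺ a<b Pab))

-- eF counts pairs with a disjunction local to Defs; the body `_` is solved by
-- the proof of eF≡countPairs, which makes that predicate nameable.
mutual
  edgePredicate : ∀ {k} {H : Graph k} → Subgraph H → Fin k → Fin k → Bool
  edgePredicate F = _

  eF≡countPairs : ∀ {k} {H : Graph k} (F : Subgraph H) → eF F ≡ countPairs (edgePredicate F)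
  eF≡countPairs F = refl

edgePredicate-true : ∀ {k} {H : Graph k} (F : Subgraph H) {a b} → es F a b ≡ true → edgePredicate F a b ≡ true
edgePredicate-true F e rewrite e = refl

unique⇒length≤eF : ∀ {k} {H : Graph k} (F : Subgraph H) {ps} → Unique ps →
  All (λ p → toℕ (proj₁ p) < toℕ (proj₂ p) × es F (proj₁ p) (proj₂ p) ≡ true) ps → length ps ≤ eF F
unique⇒length≤eF F ps! ok = subst (_ ≤_) (sym (eF≡countPairs F))
  (unique⇒length≤countPairs (edgePredicate F) ps! (All.map (λ (a<b , e) → a<b , edgePredicate-true F e) ok))

eH≤1 : ∀ {k} → k ≤ 2 → (H : Graph k) → eH H ≤ 1
eH≤1 z≤n H = z≤n
eH≤1 (s≤s z≤n) H = z≤n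
eH≤1 (s≤s (s≤s z≤n)) H with adj H zero (suc zero)
... | true = s≤s z≤n
... | false = z≤n

_∈₂_ : ∀ {A : Set} → A → A × A → Set
x ∈₂ (a , b) = x ≡ a ⊎ x ≡ b

sortPair : ∀ {k} → Fin k → Fin k → Fin k × Fin k
sortPair a b with a <? b
... | yes _ = a , b
... | no _ = b , a

∈₂-sortPair⁺ : ∀ {k} {x a b : Fin k} → x ∈₂ (a , b) → x ∈₂ sortPair a b
∈₂-sortPair⁺ {a = a} {b} x∈ with a <? b
... | yes _ = x∈
... | no _ = swap x∈

∈₂-sortPair⁻ : ∀ {k} {x a b : Fin k} → x ∈₂ sortPair a b → x ∈₂ (a , b)
∈₂-sortPair⁻ {a = a} {b} x∈ with a <? b
... | yes _ = x∈
... | no _ = swap x∈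

sortPair-≡⇒∈₂ : ∀ {k} {a b a′ b′ : Fin k} → sortPair a b ≡ sortPair a′ b′ → a′ ∈₂ (a , b) × b′ ∈₂ (a , b)
sortPair-≡⇒∈₂ {a = a} {b} {a′} {b′} eq =
  ∈₂-sortPair⁻ (subst (a′ ∈₂_) (sym eq) (∈₂-sortPair⁺ {a = a′} {b′} (inj₁ refl))) ,
  ∈₂-sortPair⁻ (subst (b′ ∈₂_) (sym eq) (∈₂-sortPair⁺ {a = a′} {b′} (inj₂ refl)))

sortPair-< : ∀ {k} {a b : Fin k} → a ≢ b → toℕ (proj₁ (sortPair a b)) < toℕ (proj₂ (sortPair a b))
sortPair-< {a = a} {b} a≢b with a <? b
... | yes a<b = a<b
... | no a≮b = ≤∧≢⇒< (≮⇒≥ a≮b) (λ b≡a → a≢b (sym (Fin.toℕ-injective b≡a)))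

sortPair-sorted : ∀ {k} {a b : Fin k} → toℕ a < toℕ b → sortPair a b ≡ (a , b)
sortPair-sorted {a = a} {b} a<b with a <? b
... | yes _ = refl
... | no a≮b = ⊥-elim (a≮b a<b)

sortPair-comm : ∀ {k} {a b : Fin k} → a ≢ b → sortPair a b ≡ sortPair b a
sortPair-comm {a = a} {b} a≢b with a <? b | b <? a
... | yes a<b | yes b<a = ⊥-elim (<-asym a<b b<a)
... | yes _ | no _ = refl
... | no _ | yes _ = refl
... | no a≮b | no b≮a = ⊥-elim (a≢b (Fin.toℕ-injective (≤-antisym (≮⇒≥ b≮a) (≮⇒≥ a≮b))))

sortPair-adj : ∀ {k} (H : Graph k) {a b} → adj H a b ≡ true →
  adj H (proj₁ (sortPair a b)) (proj₂ (sortPair a b)) ≡ true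
sortPair-adj H {a} {b} ab with a <? b
... | yes _ = ab
... | no _ = trans (Graph.sym H b a) ab

two-edges-in-three-vertices : ∀ {k} → k < 4 → (a b c d : Fin k) → a ≢ b → c ≢ d → c ∈₂ (a , b) ⊎ d ∈₂ (a , b)
two-edges-in-three-vertices k<4 a b c d a≢b c≢d
  with Fin.pigeonhole k<4 (Vec.lookup (a Vec.∷ b Vec.∷ c Vec.∷ d Vec.∷ Vec.[]))
... | zero , suc zero , _ , a≡b = ⊥-elim (a≢b a≡b)
... | zero , suc (suc zero) , _ , a≡c = inj₁ (inj₁ (sym a≡c))
... | zero , suc (suc (suc zero)) , _ , a≡d = inj₂ (inj₁ (sym a≡d))
... | suc zero , suc (suc zero) , _ , b≡c = inj₁ (inj₂ (sym b≡c))
... | suc zero , suc (suc (suc zero)) , _ , b≡d = inj₂ (inj₂ (sym b≡d))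
... | suc (suc zero) , suc (suc (suc zero)) , _ , c≡d = ⊥-elim (c≢d c≡d)
... | suc zero , suc zero , s≤s () , _
... | suc (suc _) , suc zero , s≤s () , _
... | suc (suc _) , suc (suc zero) , s≤s (s≤s ()) , _
... | suc (suc (suc _)) , suc (suc (suc zero)) , s≤s (s≤s (s≤s ())) , _

module _ {n : ℕ} where

  ends : VElt n → Fin n × Fin n
  ends w = u w , v w

  _∈ₑ_ : Fin n → VElt n → Set
  z ∈ₑ w = z ∈₂ ends w

  _∈ₑ?_ : ∀ z w → Dec (z ∈ₑ w)
  z ∈ₑ? w = (z ≟ u w) ⊎-dec (z ≟ v w)

  u≢v : ∀ (w : VElt n) → u w ≢ v w
  u≢v w u≡v = <-irrefl (cong toℕ u≡v) (u<v w)

  ∈ₑ-other : ∀ {c x y : Fin n} {w : VElt n} → c ∈ₑ w → x ∈ₑ w → y ∈ₑ w → c ≢ x → c ≢ y → x ≡ y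
  ∈ₑ-other _ (inj₁ x≡u) (inj₁ y≡u) _ _ = trans x≡u (sym y≡u)
  ∈ₑ-other _ (inj₂ x≡v) (inj₂ y≡v) _ _ = trans x≡v (sym y≡v)
  ∈ₑ-other (inj₁ c≡u) (inj₁ x≡u) _ c≢x _ = ⊥-elim (c≢x (trans c≡u (sym x≡u)))
  ∈ₑ-other (inj₂ c≡v) (inj₂ x≡v) _ c≢x _ = ⊥-elim (c≢x (trans c≡v (sym x≡v)))
  ∈ₑ-other (inj₁ c≡u) (inj₂ _) (inj₁ y≡u) _ c≢y = ⊥-elim (c≢y (trans c≡u (sym y≡u)))
  ∈ₑ-other (inj₂ c≡v) (inj₁ _) (inj₂ y≡v) _ c≢y = ⊥-elim (c≢y (trans c≡v (sym y≡v)))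

  ∈ₑ-decided : ∀ {c x y : Fin n} {w : VElt n} → c ∈ₑ w → x ∈ₑ w → y ∈ₑ w → ⌊ x ≟ c ⌋ ≡ ⌊ y ≟ c ⌋ → x ≡ y
  ∈ₑ-decided {c} {x} {y} {w} c∈ x∈ y∈ same with x ≟ c | y ≟ c
  ... | yes x≡c | yes y≡c = trans x≡c (sym y≡c)
  ... | no x≢c | no y≢c = ∈ₑ-other {w = w} c∈ x∈ y∈ (λ c≡x → x≢c (sym c≡x)) (λ c≡y → y≢c (sym c≡y))

  orientation : ∀ {x y : Fin n} {w : VElt n} → x ∈ₑ w → y ∈ₑ w → x ≢ y → (x ≡ u w × y ≡ v w) ⊎ (x ≡ v w × y ≡ u w)
  orientation (inj₁ x≡u) (inj₁ y≡u) x≢y = ⊥-elim (x≢y (trans x≡u (sym y≡u)))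
  orientation (inj₁ x≡u) (inj₂ y≡v) _ = inj₁ (x≡u , y≡v)
  orientation (inj₂ x≡v) (inj₁ y≡u) _ = inj₂ (x≡v , y≡u)
  orientation (inj₂ x≡v) (inj₂ y≡v) x≢y = ⊥-elim (x≢y (trans x≡v (sym y≡v)))

  two-common-ends : ∀ {x y : Fin n} {w w′ : VElt n} → x ∈ₑ w → y ∈ₑ w → x ∈ₑ w′ → y ∈ₑ w′ → x ≢ y →
    ends w ≡ ends w′
  two-common-ends {w = w} {w′} x∈w y∈w x∈w′ y∈w′ x≢y
    with orientation {w = w} x∈w y∈w x≢y | orientation {w = w′} x∈w′ y∈w′ x≢y
  ... | inj₁ (x≡u , y≡v) | inj₁ (x≡u′ , y≡v′) = cong₂ _,_ (trans (sym x≡u) x≡u′) (trans (sym y≡v) y≡v′)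
  ... | inj₂ (x≡v , y≡u) | inj₂ (x≡v′ , y≡u′) = cong₂ _,_ (trans (sym y≡u) y≡u′) (trans (sym x≡v) x≡v′)
  ... | inj₁ (x≡u , y≡v) | inj₂ (x≡v′ , y≡u′) =
    ⊥-elim (<-asym (subst₂ (λ a b → toℕ a < toℕ b) (sym x≡u) (sym y≡v) (u<v w))
                   (subst₂ (λ a b → toℕ a < toℕ b) (sym y≡u′) (sym x≡v′) (u<v w′)))
  ... | inj₂ (x≡v , y≡u) | inj₁ (x≡u′ , y≡v′) =
    ⊥-elim (<-asym (subst₂ (λ a b → toℕ a < toℕ b) (sym y≡u) (sym x≡v) (u<v w))
                   (subst₂ (λ a b → toℕ a < toℕ b) (sym x≡u′) (sym y≡v′) (u<v w′)))

  at-most-one-common-end : ∀ {x y : Fin n} {w w′ : VElt n} → ends w ≢ ends w′ →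
    x ∈ₑ w → x ∈ₑ w′ → y ∈ₑ w → y ∈ₑ w′ → x ≡ y
  at-most-one-common-end {x} {y} {w} {w′} w≢w′ x∈w x∈w′ y∈w y∈w′ with x ≟ y
  ... | yes x≡y = x≡y
  ... | no x≢y = ⊥-elim (w≢w′ (two-common-ends {w = w} {w′} x∈w y∈w x∈w′ y∈w′ x≢y))

  Meets : VElt n → VElt n → Set
  Meets w w′ = u w ∈ₑ w′ ⊎ v w ∈ₑ w′

  common-end⇒Meets : ∀ {z : Fin n} {w w′ : VElt n} → z ∈ₑ w → z ∈ₑ w′ → Meets w w′
  common-end⇒Meets (inj₁ refl) z∈w′ = inj₁ z∈w′
  common-end⇒Meets (inj₂ refl) z∈w′ = inj₂ z∈w′

-- outside V(U), on an edge of U meeting another one, or the lower (low) or upper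
-- (high) end of an isolated edge of U
data Kind : Set where
  outside inner low high : Kind

_==_ : Kind → Kind → Bool
outside == outside = true
inner == inner = true
low == low = true
high == high = true
_ == _ = false

==-refl : ∀ κ → (κ == κ) ≡ true
==-refl outside = refl
==-refl inner = refl
==-refl low = refl
==-refl high = refl

tally : ∀ {A : Set} → (A → Kind) → Kind → List A → ℕ
tally κ c xs = sum (map (λ x → if κ x == c then 1 else 0) xs)

kinds-partition : ∀ {A : Set} (κ : A → Kind) xs →
  tally κ outside xs + tally κ inner xs + tally κ low xs + tally κ high xs ≡ length xs
kinds-partition κ [] = refl
kinds-partition κ (x ∷ xs) with κ x | kinds-partition κ xs
... | outside | ih = cong suc ih
... | inner | ih =
  trans (cong (λ z → z + tally κ low xs + tally κ high xs) (+-suc (tally κ outside xs) _)) (cong suc ih)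
... | low | ih = trans (cong (_+ tally κ high xs) (+-suc (tally κ outside xs + tally κ inner xs) _)) (cong suc ih)
... | high | ih = trans (+-suc (tally κ outside xs + tally κ inner xs + tally κ low xs) _) (cong suc ih)

boxSize : ℕ → Kind → ℕ
boxSize m outside = m
boxSize m low = 2
boxSize m inner = 1
boxSize m high = 1

product-boxSizes : ∀ {A : Set} (κ : A → Kind) m xs →
  product (map (λ x → boxSize m (κ x)) xs) ≡ m ^ tally κ outside xs * 2 ^ tally κ low xs
product-boxSizes κ m [] = refl
product-boxSizes κ m (x ∷ xs) with κ x | product-boxSizes κ m xs
... | outside | ih = trans (cong (m *_) ih) (sym (*-assoc m _ _))
... | inner | ih = trans (*-identityˡ _) ih
... | high | ih = trans (*-identityˡ _) ih
... | low | ih =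
  trans (cong (2 *_) ih) (trans (sym (*-assoc 2 a b)) (trans (cong (_* b) (*-comm 2 a)) (*-assoc a 2 b)))
  where
  a = m ^ tally κ outside xs
  b = 2 ^ tally κ low xs

module Kinds {n : ℕ} (U : List (VElt n)) where

  Isolated : Fin n × Fin n → Set
  Isolated (x , y) = All (λ w′ → (x , y) ≡ ends w′ ⊎ ¬ (x ∈ₑ w′ ⊎ y ∈ₑ w′)) U

  isolated? : Decidable Isolated
  isolated? (x , y) =
    All.all? (λ w′ → Product.≡-dec _≟_ _≟_ (x , y) (ends w′) ⊎-dec ¬? ((x ∈ₑ? w′) ⊎-dec (y ∈ₑ? w′))) U

  non-isolated : ∀ {z : Fin n} {w w′ : VElt n} → w′ ∈ U → ends w ≢ ends w′ → z ∈ₑ w → z ∈ₑ w′ →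
    ¬ Isolated (ends w)
  non-isolated {w = w} {w′} w′∈U w≢w′ z∈w z∈w′ iso with All.lookup iso w′∈U
  ... | inj₁ w≡w′ = w≢w′ w≡w′
  ... | inj₂ ¬meets = ¬meets (common-end⇒Meets {w = w} {w′} z∈w z∈w′)

  kindIn : Fin n × Fin n → Fin n → Kind
  kindIn e z with isolated? e | z ≟ proj₁ e
  ... | yes _ | yes _ = low
  ... | yes _ | no _ = high
  ... | no _ | _ = inner

  kindOf : Fin n → Kind
  kindOf z with any? (z ∈ₑ?_) U
  ... | no _ = outside
  ... | yes z∈U = kindIn (ends (proj₁ (find z∈U))) z

  kindIn-non-isolated : ∀ {e z} → ¬ Isolated e → kindIn e z ≡ inner
  kindIn-non-isolated {e} {z} ¬iso with isolated? e
  ... | yes iso = ⊥-elim (¬iso iso)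
  ... | no _ = refl

  kindOf-edge : ∀ {z w} → w ∈ U → z ∈ₑ w → kindOf z ≡ kindIn (ends w) z
  kindOf-edge {z} {w} w∈U z∈w with any? (z ∈ₑ?_) U
  ... | no z∉U = ⊥-elim (z∉U (lose w∈U z∈w))
  ... | yes z∈U with find z∈U
  ...   | w₁ , w₁∈U , z∈w₁ with Product.≡-dec _≟_ _≟_ (ends w₁) (ends w)
  ...     | yes w₁≡w = cong (λ e → kindIn e z) w₁≡w
  ...     | no w₁≢w = trans (kindIn-non-isolated (non-isolated {w = w₁} w∈U w₁≢w z∈w₁ z∈w))
                            (sym (kindIn-non-isolated (non-isolated {w = w} w₁∈U (λ e → w₁≢w (sym e)) z∈w z∈w₁)))

  kindOf-low : ∀ {w} → w ∈ U → Isolated (ends w) → kindOf (u w) ≡ low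
  kindOf-low {w} w∈U iso with kindOf (u w) | kindOf-edge {u w} {w} w∈U (inj₁ refl)
  ... | _ | refl with isolated? (ends w) | u w ≟ u w
  ...   | yes _ | yes _ = refl
  ...   | yes _ | no u≢u = ⊥-elim (u≢u refl)
  ...   | no ¬iso | _ = ⊥-elim (¬iso iso)

  kindOf-high : ∀ {w} → w ∈ U → Isolated (ends w) → kindOf (v w) ≡ high
  kindOf-high {w} w∈U iso with kindOf (v w) | kindOf-edge {v w} {w} w∈U (inj₂ refl)
  ... | _ | refl with isolated? (ends w) | v w ≟ u w
  ...   | yes _ | no _ = refl
  ...   | yes _ | yes v≡u = ⊥-elim (u≢v w (sym v≡u))
  ...   | no ¬iso | _ = ⊥-elim (¬iso iso)

  kindOf-inner : ∀ {z w} → w ∈ U → ¬ Isolated (ends w) → z ∈ₑ w → kindOf z ≡ inner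
  kindOf-inner w∈U ¬iso z∈w = trans (kindOf-edge w∈U z∈w) (kindIn-non-isolated ¬iso)

  kindOf-inside : ∀ {z} → kindOf z ≢ outside → ∃ λ w → w ∈ U × z ∈ₑ w
  kindOf-inside {z} ≢outside with any? (z ∈ₑ?_) U
  ... | no _ = ⊥-elim (≢outside refl)
  ... | yes z∈U = find z∈U

-- Copies of H through the edges U, grouped by the edges of H that cover U

module Covering {k n : ℕ} (H : Graph k) (U : List (VElt n)) where
  open Kinds U

  Covers : Copy n H → Set
  Covers L = All (λ w → InL L (u w) (v w)) U

  CoveringCopy : Set
  CoveringCopy = Σ (Copy n H) Covers

  record Preimage (L : Copy n H) : Set where
    constructor mkPreimage
    field
      edge : VElt n
      src tgt : Fin k
      adjacent : adj H src tgt ≡ true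
      src↦ : f L src ≡ u edge
      tgt↦ : f L tgt ≡ v edge
  open Preimage public

  preimagesOf : ∀ L {W} → All (λ w → InL L (u w) (v w)) W → List (Preimage L)
  preimagesOf L [] = []
  preimagesOf L {w ∷ _} ((a , b , ab , fa , fb) ∷ c) = mkPreimage w a b ab fa fb ∷ preimagesOf L c

  edges-preimagesOf : ∀ L {W} (c : All (λ w → InL L (u w) (v w)) W) → map edge (preimagesOf L c) ≡ W
  edges-preimagesOf L [] = refl
  edges-preimagesOf L (_ ∷ c) = cong (_ ∷_) (edges-preimagesOf L c)

  preimages : (E : CoveringCopy) → List (Preimage (proj₁ E))
  preimages (L , c) = preimagesOf L c

  edges-preimages : ∀ E → map edge (preimages E) ≡ U
  edges-preimages (L , c) = edges-preimagesOf L c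

  preimage-of : ∀ E {w} → w ∈ U → ∃ λ t → t ∈ preimages E × edge t ≡ w
  preimage-of E w∈U with ∈-map⁻ edge (subst (_ ∈_) (sym (edges-preimages E)) w∈U)
  ... | t , t∈ , refl = t , t∈ , refl

  edge∈U : ∀ {E t} → t ∈ preimages E → edge t ∈ U
  edge∈U {E} t∈ = subst (_ ∈_) (edges-preimages E) (∈-map⁺ edge t∈)

  src≢tgt : ∀ {L} (t : Preimage L) → src t ≢ tgt t
  src≢tgt {L} t s≡t = u≢v (edge t) (trans (sym (src↦ t)) (trans (cong (f L) s≡t) (tgt↦ t)))

  image-∈ₑ : ∀ {L} (t : Preimage L) {x} → x ∈₂ (src t , tgt t) → f L x ∈ₑ edge t
  image-∈ₑ t (inj₁ refl) = inj₁ (src↦ t)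
  image-∈ₑ t (inj₂ refl) = inj₂ (tgt↦ t)

  preimage-∈₂ : ∀ {L} (t : Preimage L) {x} → f L x ∈ₑ edge t → x ∈₂ (src t , tgt t)
  preimage-∈₂ {L} t (inj₁ fx≡u) = inj₁ (inj L _ _ (trans fx≡u (sym (src↦ t))))
  preimage-∈₂ {L} t (inj₂ fx≡v) = inj₂ (inj L _ _ (trans fx≡v (sym (tgt↦ t))))

  preimagePair : ∀ {L} → Preimage L → Fin k × Fin k
  preimagePair t = sortPair (src t) (tgt t)

  key : CoveringCopy → List (Fin k × Fin k)
  key E = map preimagePair (preimages E)

  length-key : ∀ E → length (key E) ≡ length U
  length-key E = trans (length-map preimagePair (preimages E))
    (trans (sym (length-map edge (preimages E))) (cong length (edges-preimages E)))

  key-⊆-edges : ∀ E {p} → p ∈ key E → p ∈ pairsWith (adj H)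
  key-⊆-edges E p∈ with ∈-map⁻ preimagePair p∈
  ... | t , _ , refl = ∈-pairsWith⁺ (sortPair-< (src≢tgt t)) (sortPair-adj H (adjacent t))

  preimagePair-injective : ∀ {L} (t t′ : Preimage L) → preimagePair t ≡ preimagePair t′ →
    ends (edge t) ≡ ends (edge t′)
  preimagePair-injective {L} t t′ eq with sortPair-≡⇒∈₂ eq
  ... | a′∈ , b′∈ = two-common-ends {w = edge t} {edge t′} (subst (_∈ₑ edge t) (src↦ t′) (image-∈ₑ t a′∈))
      (subst (_∈ₑ edge t) (tgt↦ t′) (image-∈ₑ t b′∈)) (inj₁ refl) (inj₂ refl) (u≢v (edge t′))

  DistinctEnds : List (VElt n) → Set
  DistinctEnds = AllPairs (λ w w′ → ends w ≢ ends w′)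

  key-unique : DistinctEnds U → ∀ E → Unique (key E)
  key-unique U! E = AllPairs.map⁺ (AP.map (λ {t} {t′} ≢ eq → ≢ (preimagePair-injective t t′ eq))
    (AllPairs.map⁻ (subst DistinctEnds (sym (edges-preimages E)) U!)))

  MapsOnto : (Fin k → Fin n) → ∀ {L} → Preimage L → Set
  MapsOnto g t = g (src t) ∈ₑ edge t × g (tgt t) ∈ₑ edge t

  MapsOnto-∈₂ : ∀ g {L} (t : Preimage L) {s} → MapsOnto g t → s ∈₂ (src t , tgt t) → g s ∈ₑ edge t
  MapsOnto-∈₂ g t maps (inj₁ refl) = proj₁ maps
  MapsOnto-∈₂ g t maps (inj₂ refl) = proj₂ maps

  same-key⇒MapsOnto : ∀ E E₀ → key E ≡ key E₀ → ∀ {t} → t ∈ preimages E₀ → MapsOnto (f (proj₁ E)) t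
  same-key⇒MapsOnto (L , c) (L₀ , c₀) = go c c₀
    where
    go : ∀ {W} (c : All (λ w → InL L (u w) (v w)) W) (c₀ : All (λ w → InL L₀ (u w) (v w)) W) →
      map preimagePair (preimagesOf L c) ≡ map preimagePair (preimagesOf L₀ c₀) →
      ∀ {t} → t ∈ preimagesOf L₀ c₀ → MapsOnto (f L) t
    go {w ∷ _} ((a , b , ab , fa , fb) ∷ _) ((_ , _ , _ , _ , _) ∷ _) eq (here refl)
      with sortPair-≡⇒∈₂ (proj₁ (∷-injective eq))
    ... | a₀∈ , b₀∈ = image-∈ₑ t a₀∈ , image-∈ₑ t b₀∈
      where t = mkPreimage {L} w a b ab fa fb
    go ((_ , _ , _ , _ , _) ∷ c) ((_ , _ , _ , _ , _) ∷ c₀) eq (there t∈) =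
      go c c₀ (proj₂ (∷-injective eq)) t∈

  module Class (E₀ : CoveringCopy) where

    L₀ = proj₁ E₀
    f₀ = f L₀

    kind : Fin k → Kind
    kind x = kindOf (f₀ x)

    -- A copy in the class of E₀ is recovered from its code: its values off f₀⁻¹(V(U)), and
    -- at the lower end of each isolated edge whether it agrees with f₀; the rest is forced.
    code : (Fin k → Fin n) → Fin k → Fin n ⊎ Bool
    code g x with kind x
    ... | outside = inj₁ (g x)
    ... | low = inj₂ ⌊ g x ≟ f₀ x ⌋
    ... | inner = inj₂ false
    ... | high = inj₂ false

    box : Fin k → List (Fin n ⊎ Bool)
    box x with kind x
    ... | outside = map inj₁ (allFin n)
    ... | low = inj₂ true ∷ inj₂ false ∷ []
    ... | inner = inj₂ false ∷ []
    ... | high = inj₂ false ∷ []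

    code∈box : ∀ g x → code g x ∈ box x
    code∈box g x with kind x
    ... | outside = ∈-map⁺ inj₁ (∈-allFin (g x))
    ... | inner = here refl
    ... | high = here refl
    ... | low with g x ≟ f₀ x
    ...   | yes _ = here refl
    ...   | no _ = there (here refl)

    code-outside : ∀ {g x} → kind x ≡ outside → code g x ≡ inj₁ (g x)
    code-outside {g} {x} kx with kind x
    ... | outside = refl

    code-low : ∀ {g x} → kind x ≡ low → code g x ≡ inj₂ ⌊ g x ≟ f₀ x ⌋
    code-low {g} {x} kx with kind x
    ... | low = refl

    InClass : Copy n H → Set
    InClass L = ∀ {t} → t ∈ preimages E₀ → MapsOnto (f L) t

    shared-end : ∀ {t} → t ∈ preimages E₀ → ¬ Isolated (ends (edge t)) →
      ∃ λ t′ → t′ ∈ preimages E₀ × ends (edge t) ≢ ends (edge t′) ×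
               ∃ λ s → s ∈₂ (src t , tgt t) × s ∈₂ (src t′ , tgt t′)
    shared-end {t} t∈ ¬iso with find (¬All⇒Any¬ (λ w′ → Product.≡-dec _≟_ _≟_ (ends w) (ends w′) ⊎-dec
                                         ¬? ((u w ∈ₑ? w′) ⊎-dec (v w ∈ₑ? w′))) U ¬iso)
      where w = edge t
    ... | w′ , w′∈U , ¬[same⊎apart] with preimage-of E₀ w′∈U
    ...   | t′ , t′∈ , refl = t′ , t′∈ , (λ same → ¬[same⊎apart] (inj₁ same)) , end meets
      where
      meets : Meets (edge t) (edge t′)
      meets = decidable-stable ((u (edge t) ∈ₑ? edge t′) ⊎-dec (v (edge t) ∈ₑ? edge t′))
                               (λ apart → ¬[same⊎apart] (inj₂ apart))
      end : Meets (edge t) (edge t′) → ∃ λ s → s ∈₂ (src t , tgt t) × s ∈₂ (src t′ , tgt t′)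
      end (inj₁ u∈) = src t , inj₁ refl , preimage-∈₂ t′ (subst (_∈ₑ edge t′) (sym (src↦ t)) u∈)
      end (inj₂ v∈) = tgt t , inj₂ refl , preimage-∈₂ t′ (subst (_∈ₑ edge t′) (sym (tgt↦ t)) v∈)

    module Decode (L L′ : Copy n H) (L∈ : InClass L) (L′∈ : InClass L′)
                  (same-code : ∀ x → code (f L) x ≡ code (f L′) x) where

      -- An isolated edge is fixed by the bit at its lower end; any other edge shares an end with
      -- a second edge of U, and two distinct edges of K_n have at most one common end.
      agree-at-one-end : ∀ {t} → t ∈ preimages E₀ → ∃ λ s → s ∈₂ (src t , tgt t) × f L s ≡ f L′ s
      agree-at-one-end {t} t∈ with isolated? (ends (edge t))
      ... | yes iso =
        src t , inj₁ refl , ∈ₑ-decided {w = edge t} (inj₁ (src↦ t)) (proj₁ (L∈ t∈)) (proj₁ (L′∈ t∈)) same-bit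
        where
        low-src : kind (src t) ≡ low
        low-src = trans (cong kindOf (src↦ t)) (kindOf-low (edge∈U {E₀} t∈) iso)
        same-bit : ⌊ f L (src t) ≟ f₀ (src t) ⌋ ≡ ⌊ f L′ (src t) ≟ f₀ (src t) ⌋
        same-bit = inj₂-injective
          (trans (sym (code-low low-src)) (trans (same-code (src t)) (code-low low-src)))
      ... | no ¬iso with shared-end t∈ ¬iso
      ...   | t′ , t′∈ , t≢t′ , s , s∈t , s∈t′ = s , s∈t ,
        at-most-one-common-end {w = edge t} {edge t′} t≢t′
          (MapsOnto-∈₂ (f L) t (L∈ t∈) s∈t) (MapsOnto-∈₂ (f L) t′ (L∈ t′∈) s∈t′)
          (MapsOnto-∈₂ (f L′) t (L′∈ t∈) s∈t) (MapsOnto-∈₂ (f L′) t′ (L′∈ t′∈) s∈t′)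

      agree-on-preimage : ∀ {t} → t ∈ preimages E₀ → ∀ {x} → x ∈₂ (src t , tgt t) → f L x ≡ f L′ x
      agree-on-preimage {t} t∈ x∈ with agree-at-one-end t∈
      ... | s , s∈ , same = spread s∈ same x∈
        where
        other : ∀ {a b} → a ∈₂ (src t , tgt t) → b ∈₂ (src t , tgt t) → a ≢ b →
          f L a ≡ f L′ a → f L b ≡ f L′ b
        other a∈ b∈ a≢b fa≡ = ∈ₑ-other {w = edge t}
          (MapsOnto-∈₂ (f L) t (L∈ t∈) a∈) (MapsOnto-∈₂ (f L) t (L∈ t∈) b∈) (MapsOnto-∈₂ (f L′) t (L′∈ t∈) b∈)
          (λ e → a≢b (inj L _ _ e)) (λ e → a≢b (inj L′ _ _ (trans (sym fa≡) e)))
        spread : ∀ {a b} → a ∈₂ (src t , tgt t) → f L a ≡ f L′ a → b ∈₂ (src t , tgt t) → f L b ≡ f L′ b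
        spread (inj₁ refl) fa≡ (inj₁ refl) = fa≡
        spread (inj₂ refl) fa≡ (inj₂ refl) = fa≡
        spread (inj₁ refl) fa≡ (inj₂ refl) = other (inj₁ refl) (inj₂ refl) (src≢tgt t) fa≡
        spread (inj₂ refl) fa≡ (inj₁ refl) = other (inj₂ refl) (inj₁ refl) (λ e → src≢tgt t (sym e)) fa≡

      agree-inside : ∀ x → kind x ≢ outside → f L x ≡ f L′ x
      agree-inside x ≢outside with kindOf-inside ≢outside
      ... | w , w∈U , fx∈w with preimage-of E₀ w∈U
      ...   | t , t∈ , refl = agree-on-preimage t∈ (preimage-∈₂ t fx∈w)

      decode : f L ≗ f L′
      decode x with kind x in kx
      ... | outside = inj₁-injective (trans (sym (code-outside kx)) (trans (same-code x) (code-outside kx)))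
      ... | inner = agree-inside x (λ o → contradiction (trans (sym kx) o) λ ())
      ... | low = agree-inside x (λ o → contradiction (trans (sym kx) o) λ ())
      ... | high = agree-inside x (λ o → contradiction (trans (sym kx) o) λ ())

    #_ : Kind → ℕ
    # κ = count (λ x → kind x == κ)

    box-length : ∀ x → length (box x) ≡ boxSize n (kind x)
    box-length x with kind x
    ... | outside = trans (length-map inj₁ (allFin n)) (length-tabulate (λ z → z))
    ... | inner = refl
    ... | low = refl
    ... | high = refl

    class-size-bound : ∀ (Ls : List (Copy n H)) → AllPairs (λ L L′ → ¬ f L ≗ f L′) Ls → All InClass Ls →
      length Ls ≤ n ^ # outside * 2 ^ # low
    class-size-bound Ls Ls! Ls∈ = subst₂ _≤_ (length-map codeOf Ls) box-product
      (distinct-functions≤product (Sum.≡-dec _≟_ Bool._≟_) k box (map codeOf Ls)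
        (AllPairs-map-on codeOf (λ {L} {L′} L∈ L′∈ L≉L′ same → L≉L′ (Decode.decode L L′ L∈ L′∈ same)) Ls∈ Ls!)
        codes∈box)
      where
      codeOf : Copy n H → Fin k → Fin n ⊎ Bool
      codeOf L = code (f L)
      codes∈box : ∀ {h} → h ∈ map codeOf Ls → ∀ x → h x ∈ box x
      codes∈box h∈ x with ∈-map⁻ codeOf h∈
      ... | L , _ , refl = code∈box (f L) x
      box-product : product (tabulate (length ∘ box)) ≡ n ^ # outside * 2 ^ # low
      box-product = trans
        (cong product (trans (tabulate-cong box-length) (sym (map-tabulate id (λ x → boxSize n (kind x))))))
        (product-boxSizes kind n (allFin k))

    module Bounds (U! : DistinctEnds U) where

      preimages-apart : AllPairs (λ t t′ → ends (edge t) ≢ ends (edge t′)) (preimages E₀)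
      preimages-apart = AllPairs.map⁻ (subst DistinctEnds (sym (edges-preimages E₀)) U!)

      isolated-preimage? : Decidable (λ (t : Preimage L₀) → Isolated (ends (edge t)))
      isolated-preimage? t = isolated? (ends (edge t))

      isolatedPreimages linkedPreimages : List (Preimage L₀)
      isolatedPreimages = filter isolated-preimage? (preimages E₀)
      linkedPreimages = filter (λ t → ¬? (isolated-preimage? t)) (preimages E₀)

      ∈linked : ∀ {t} → t ∈ linkedPreimages → t ∈ preimages E₀ × ¬ Isolated (ends (edge t))
      ∈linked = ∈-filter⁻ (λ t → ¬? (isolated-preimage? t))

      ι ν : ℕ
      ι = length isolatedPreimages
      ν = length linkedPreimages

      ι+ν≡|U| : ι + ν ≡ length U
      ι+ν≡|U| = trans (length-filter-complement isolated-preimage? (preimages E₀))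
        (trans (sym (length-map edge (preimages E₀))) (cong length (edges-preimages E₀)))

      isolated-endpoints : (end : Preimage L₀ → Fin k) (κ : Kind) → (∀ t → f₀ (end t) ∈ₑ edge t) →
        (∀ {t} → t ∈ preimages E₀ → Isolated (ends (edge t)) → kind (end t) ≡ κ) → ι ≤ # κ
      isolated-endpoints end κ end∈ kind-end = subst (_≤ # κ) (length-map end isolatedPreimages)
        (unique⇒length≤count (λ x → kind x == κ) ends! all-κ)
        where
        ∈iso : ∀ {t} → t ∈ isolatedPreimages → t ∈ preimages E₀ × Isolated (ends (edge t))
        ∈iso = ∈-filter⁻ isolated-preimage?
        apart : ∀ {t t′} → t ∈ preimages E₀ × Isolated (ends (edge t)) →
          t′ ∈ preimages E₀ × Isolated (ends (edge t′)) → ends (edge t) ≢ ends (edge t′) → end t ≢ end t′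
        apart {t} {t′} (t∈ , iso) (t′∈ , _) t≢t′ same with All.lookup iso (edge∈U {E₀} t′∈)
        ... | inj₁ t≡t′ = t≢t′ t≡t′
        ... | inj₂ ¬meets = ¬meets (common-end⇒Meets {w = edge t} {edge t′} (end∈ t)
                                      (subst (_∈ₑ edge t′) (cong f₀ (sym same)) (end∈ t′)))
        ends! : Unique (map end isolatedPreimages)
        ends! = AllPairs-map-on end apart (All.tabulate ∈iso)
                  (AllPairs.filter⁺ isolated-preimage? preimages-apart)
        all-κ : All (λ x → (kind x == κ) ≡ true) (map end isolatedPreimages)
        all-κ = All.tabulate λ x∈ → case ∈-map⁻ end x∈ of λ where
          (t , t∈ , refl) → subst (λ c → (c == κ) ≡ true) (sym (uncurry kind-end (∈iso t∈))) (==-refl κ)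

      ι≤#low : ι ≤ # low
      ι≤#low = isolated-endpoints src low (λ t → inj₁ (src↦ t))
        (λ {t} t∈ iso → trans (cong kindOf (src↦ t)) (kindOf-low (edge∈U {E₀} t∈) iso))

      ι≤#high : ι ≤ # high
      ι≤#high = isolated-endpoints tgt high (λ t → inj₂ (tgt↦ t))
        (λ {t} t∈ iso → trans (cong kindOf (tgt↦ t)) (kindOf-high (edge∈U {E₀} t∈) iso))

      inner-on-linked : ∀ {t} → t ∈ preimages E₀ → ¬ Isolated (ends (edge t)) →
        ∀ {x} → x ∈₂ (src t , tgt t) → kind x ≡ inner
      inner-on-linked {t} t∈ ¬iso x∈ = kindOf-inner (edge∈U {E₀} t∈) ¬iso (image-∈ₑ t x∈)

      otherEnd : ∀ {L} (t : Preimage L) {s} → s ∈₂ (src t , tgt t) → Fin k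
      otherEnd t (inj₁ _) = tgt t
      otherEnd t (inj₂ _) = src t

      otherEnd-∈₂ : ∀ {L} (t : Preimage L) {s} (s∈ : s ∈₂ (src t , tgt t)) → otherEnd t s∈ ∈₂ (src t , tgt t)
      otherEnd-∈₂ t (inj₁ _) = inj₂ refl
      otherEnd-∈₂ t (inj₂ _) = inj₁ refl

      otherEnd-≢ : ∀ {L} (t : Preimage L) {s} (s∈ : s ∈₂ (src t , tgt t)) → s ≢ otherEnd t s∈
      otherEnd-≢ t (inj₁ refl) = src≢tgt t
      otherEnd-≢ t (inj₂ refl) = λ e → src≢tgt t (sym e)

      3≤#inner : 1 ≤ ν → 3 ≤ # inner
      3≤#inner 1≤ν with linkedPreimages | 1≤ν | All.tabulate {xs = linkedPreimages} ∈linked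
      ... | t ∷ _ | _ | (t∈ , ¬iso) ∷ _ with shared-end t∈ ¬iso
      ...   | t′ , t′∈ , t≢t′ , s , s∈t , s∈t′ =
        unique⇒length≤count (λ x → kind x == inner) three!
          (is-inner (inj₁ refl) ∷ is-inner (inj₂ refl) ∷ o-inner ∷ [])
        where
        o = otherEnd t′ s∈t′
        o∉t : ¬ o ∈₂ (src t , tgt t)
        o∉t o∈t = t≢t′ (two-common-ends {w = edge t} {edge t′} (image-∈ₑ t s∈t) (image-∈ₑ t o∈t)
                    (image-∈ₑ t′ s∈t′) (image-∈ₑ t′ (otherEnd-∈₂ t′ s∈t′))
                    (λ e → otherEnd-≢ t′ s∈t′ (inj L₀ _ _ e)))
        three! : Unique (src t ∷ tgt t ∷ o ∷ [])
        three! = (src≢tgt t ∷ (λ e → o∉t (inj₁ (sym e))) ∷ []) ∷ ((λ e → o∉t (inj₂ (sym e))) ∷ []) ∷ [] ∷ []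
        is-inner : ∀ {x} → x ∈₂ (src t , tgt t) → (kind x == inner) ≡ true
        is-inner x∈ rewrite inner-on-linked t∈ ¬iso x∈ = refl
        ¬iso′ : ¬ Isolated (ends (edge t′))
        ¬iso′ = non-isolated {w = edge t′} {edge t} (edge∈U {E₀} t∈) (λ e → t≢t′ (sym e))
                  (image-∈ₑ t′ s∈t′) (image-∈ₑ t s∈t)
        o-inner : (kind o == inner) ≡ true
        o-inner rewrite inner-on-linked t′∈ ¬iso′ (otherEnd-∈₂ t′ s∈t′) = refl

      innerSubgraph : Subgraph H
      innerSubgraph = record
        { vs = λ x → kind x == inner
        ; es = λ a b → (kind a == inner) ∧ (kind b == inner) ∧ adj H a b
        ; es-sub = λ a b e → let ia , ib∧ab = ∧-true e ; ib , ab = ∧-true ib∧ab in ab , ia , ib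
        }
        where
        ∧-true : ∀ {x y} → x ∧ y ≡ true → x ≡ true × y ≡ true
        ∧-true {true} {true} _ = refl , refl

      ν≤eF : ν ≤ eF innerSubgraph
      ν≤eF = subst (_≤ eF innerSubgraph) (length-map preimagePair linkedPreimages)
        (unique⇒length≤eF innerSubgraph pairs! (All.tabulate pair-ok))
        where
        pairs! : Unique (map preimagePair linkedPreimages)
        pairs! = AllPairs.map⁺ (AP.map (λ {t} {t′} ≢ eq → ≢ (preimagePair-injective t t′ eq))
          (AllPairs.filter⁺ (λ t → ¬? (isolated-preimage? t)) preimages-apart))
        pair-ok : ∀ {p} → p ∈ map preimagePair linkedPreimages →
          toℕ (proj₁ p) < toℕ (proj₂ p) × es innerSubgraph (proj₁ p) (proj₂ p) ≡ true
        pair-ok p∈ with ∈-map⁻ preimagePair p∈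
        ... | t , t∈ , refl with ∈linked t∈
        ...   | t∈hits , ¬iso
          rewrite inner-on-linked t∈hits ¬iso (∈₂-sortPair⁻ {a = src t} {tgt t} (inj₁ refl))
                | inner-on-linked t∈hits ¬iso (∈₂-sortPair⁻ {a = src t} {tgt t} (inj₂ refl))
                | sortPair-adj H (adjacent t) = sortPair-< (src≢tgt t) , refl

  _≟ₖ_ : DecidableEquality (List (Fin k × Fin k))
  _≟ₖ_ = List.≡-dec (Product.≡-dec _≟_ _≟_)

  module _ (U! : DistinctEnds U) where

    keys-count : ∀ Es → length (deduplicate _≟ₖ_ (map key Es)) ≤ falling (eH H) (length U)
    keys-count Es = subst (λ m → length keys ≤ falling m (length U)) (length-pairsWith (adj H))
        (unique-lists≤falling (Product.≡-dec _≟_ _≟_) (length U) (pairsWith (adj H)) keys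
          (deduplicate-! _≟ₖ_ (map key Es)) key-ok)
      where
      keys = deduplicate _≟ₖ_ (map key Es)
      key-ok : ∀ {s} → s ∈ keys → Unique s × length s ≡ length U × (∀ {p} → p ∈ s → p ∈ pairsWith (adj H))
      key-ok s∈ with ∈-map⁻ key (∈-deduplicate⁻ _≟ₖ_ (map key Es) s∈)
      ... | E′ , _ , refl = key-unique U! E′ , length-key E′ , key-⊆-edges E′

    class-size-of-key : ∀ E₀ Es → AllPairs (λ E E′ → ¬ f (proj₁ E) ≗ f (proj₁ E′)) Es →
      length (fibre _≟ₖ_ key (key E₀) Es) ≤ n ^ Class.#_ E₀ outside * 2 ^ Class.#_ E₀ low
    class-size-of-key E₀ Es Es! = subst (_≤ _) (length-map proj₁ F)
        (Class.class-size-bound E₀ (map proj₁ F) (AllPairs.map⁺ (AllPairs.filter⁺ same-key? Es!))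
          (All.map⁺ (All.tabulate λ E′∈ → same-key⇒MapsOnto _ E₀ (proj₂ (∈-filter⁻ same-key? {xs = Es} E′∈)))))
      where
      F = fibre _≟ₖ_ key (key E₀) Es
      same-key? = λ E′ → key E′ ≟ₖ key E₀

    copies-by-class : ∀ E Es → AllPairs (λ E E′ → ¬ f (proj₁ E) ≗ f (proj₁ E′)) (E ∷ Es) →
      ∃ λ E₀ → length (E ∷ Es) ≤ falling (eH H) (length U) * (n ^ Class.#_ E₀ outside * 2 ^ Class.#_ E₀ low)
    copies-by-class E Es Es! =
      let E₀ , total = largest-fibre _≟ₖ_ key (deduplicate _≟ₖ_ (map key (E ∷ Es))) E Es
                         (λ E′∈ → ∈-deduplicate⁺ _≟ₖ_ (∈-map⁺ key E′∈))
      in E₀ , ≤-trans total (*-mono-≤ (keys-count (E ∷ Es)) (class-size-of-key E₀ (E ∷ Es) Es!))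

^-distribʳ-* : ∀ m n p → (m * n) ^ p ≡ m ^ p * n ^ p
^-distribʳ-* m n zero = refl
^-distribʳ-* m n (suc p) = trans (cong (m * n *_) (^-distribʳ-* m n p))
  (solve 4 (λ m n x y → (m :* n) :* (x :* y) := (m :* x) :* (n :* y)) refl m n (m ^ p) (n ^ p))

powers-from-density : ∀ {X Y n a b p q} → 1 ≤ n → X * n ^ b ≤ Y → a * q ≤ b * p → X ^ p * n ^ (a * q) ≤ Y ^ p
powers-from-density {X} {Y} {n} {a} {b} {p} {q} 1≤n Xnᵇ≤Y aq≤bp = begin
  X ^ p * n ^ (a * q)    ≤⟨ *-monoʳ-≤ (X ^ p) (^-monoʳ-≤ n {{>-nonZero 1≤n}} aq≤bp) ⟩
  X ^ p * n ^ (b * p)    ≡⟨ cong (X ^ p *_) (^-*-assoc n b p) ⟨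
  X ^ p * (n ^ b) ^ p    ≡⟨ ^-distribʳ-* X (n ^ b) p ⟨
  (X * n ^ b) ^ p        ≤⟨ ^-monoˡ-≤ p Xnᵇ≤Y ⟩
  Y ^ p                  ∎
  where open ≤-Reasoning

merge-powers : ∀ {n x y z} → 1 ≤ n → x + y ≤ z → n ^ x * n ^ y ≤ n ^ z
merge-powers {n} {x} {y} 1≤n x+y≤z = subst (_≤ _) (^-distribˡ-+-* n x y) (^-monoʳ-≤ n {{>-nonZero 1≤n}} x+y≤z)

2^≤2*^∸1 : ∀ {n} c → 2 ≤ n → 1 ≤ c → 2 ^ c ≤ 2 * n ^ (c ∸ 1)
2^≤2*^∸1 (suc c) 2≤n _ = *-monoʳ-≤ 2 (^-monoˡ-≤ c 2≤n)

2^≤^∸1 : ∀ {n} c → 4 ≤ n → 2 ≤ c → 2 ^ c ≤ n ^ (c ∸ 1)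
2^≤^∸1 (suc zero) _ (s≤s ())
2^≤^∸1 {n} (suc (suc c)) 4≤n _ = begin
  2 * (2 * 2 ^ c)   ≡⟨ *-assoc 2 2 (2 ^ c) ⟨
  4 * 2 ^ c         ≤⟨ *-mono-≤ 4≤n (^-monoˡ-≤ c (≤-trans (s≤s (s≤s z≤n)) 4≤n)) ⟩
  n * n ^ c         ∎
  where open ≤-Reasoning

2*e≤e! : ∀ e → 3 ≤ e → 2 * e ≤ e !
2*e≤e! (suc zero) (s≤s ())
2*e≤e! (suc (suc zero)) (s≤s (s≤s ()))
2*e≤e! (suc (suc (suc e))) _ = begin
  2 * (3 + e)          ≡⟨ *-comm 2 (3 + e) ⟩
  (3 + e) * 2          ≤⟨ *-monoʳ-≤ (3 + e) (*-mono-≤ (s≤s (s≤s (z≤n {e}))) (1≤n! (suc e))) ⟩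
  (3 + e) * (2 + e) !  ∎
  where open ≤-Reasoning

copies-density : ∀ {X e j n k N c₁ D c b} → 1 ≤ n →
  X ≤ falling e j * (n ^ N * 2 ^ c₁) → 2 ^ c₁ ≤ D * n ^ c → D * falling e j ≤ e ! → N + c + b ≤ k ∸ 2 →
  X * n ^ b ≤ e ! * n ^ (k ∸ 2)
copies-density {X} {e} {j} {n} {k} {N} {c₁} {D} {c} {b} 1≤n X≤ 2^c₁≤ D≤ exponent≤ = begin
  X * n ^ b
    ≤⟨ *-monoˡ-≤ (n ^ b) (≤-trans X≤ (*-monoʳ-≤ (falling e j) (*-monoʳ-≤ (n ^ N) 2^c₁≤))) ⟩
  falling e j * (n ^ N * (D * n ^ c)) * n ^ b
    ≡⟨ solve 5 (λ F x D y z → F :* (x :* (D :* y)) :* z := (D :* F) :* ((x :* y) :* z))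
             refl (falling e j) (n ^ N) D (n ^ c) (n ^ b) ⟩
  D * falling e j * (n ^ N * n ^ c * n ^ b)
    ≤⟨ *-mono-≤ D≤ (≤-trans (*-monoˡ-≤ (n ^ b) (merge-powers {n} {N} {c} 1≤n ≤-refl))
                            (merge-powers {n} {N + c} {b} 1≤n exponent≤)) ⟩
  e ! * n ^ (k ∸ 2)
    ∎
  where open ≤-Reasoning

-- N, t, c₁, c₂ count the vertices of H of each kind, ι and ν the isolated and the
-- other edges of U, e = e(H) and j = |U|.
module _ {X e j p q n k N t c₁ c₂ ι : ℕ} (X≤ : X ≤ falling e j * (n ^ N * 2 ^ c₁))
         (partition : N + t + c₁ + c₂ ≡ k) (ι≤c₁ : ι ≤ c₁) (ι≤c₂ : ι ≤ c₂) (q≤p : q ≤ p) (k≤n : k ≤ n) where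

  private
    open ≤-Reasoning

    t≤k : t ≤ k
    t≤k = ≤-trans (≤-trans (≤-trans (m≤n+m t N) (m≤m+n (N + t) c₁)) (m≤m+n (N + t + c₁) c₂)) (≤-reflexive partition)

    c₁+c₂≤k : c₁ + c₂ ≤ k
    c₁+c₂≤k = ≤-trans (m≤n+m (c₁ + c₂) (N + t)) (≤-reflexive (trans (sym (+-assoc (N + t) c₁ c₂)) partition))

    N+c₁+c₂≤k : N + c₁ + c₂ ≤ k
    N+c₁+c₂≤k = ≤-trans (+-monoˡ-≤ c₂ (+-monoˡ-≤ c₁ (m≤m+n N t))) (≤-reflexive partition)

    room : ∀ {x} → x + 2 ≤ k → x ≤ k ∸ 2
    room {x} = m+n≤o⇒m≤o∸n x

    falling≤!′ : 1 * falling e j ≤ e !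
    falling≤!′ = ≤-trans (≤-reflexive (*-identityˡ _)) (falling≤! j e)

    linked-case : ∀ {ν′} → ι + suc ν′ ≡ j → 3 ≤ t → ν′ * q ≤ p * (t ∸ 2) →
      X ^ p * n ^ ((j ∸ 1) * q) ≤ (e ! * n ^ (k ∸ 2)) ^ p
    linked-case {ν′} ι+ν≡j 3≤t ν′q≤ =
      powers-from-density {X} {e ! * n ^ (k ∸ 2)} {n} {j ∸ 1} {ι + (t ∸ 2)} {p} {q} 1≤n
        (copies-density {X} {e} {j} {n} {k} {N} {c₁} {1} {c₁} {ι + (t ∸ 2)} 1≤n X≤ 2^c₁≤ falling≤!′ (room exponent))
        aq≤bp
      where
      2≤n : 2 ≤ n
      2≤n = ≤-trans (≤-trans (s≤s (s≤s z≤n)) (≤-trans 3≤t t≤k)) k≤n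
      1≤n : 1 ≤ n
      1≤n = ≤-trans (s≤s z≤n) 2≤n
      2^c₁≤ : 2 ^ c₁ ≤ 1 * n ^ c₁
      2^c₁≤ = ≤-trans (^-monoˡ-≤ c₁ 2≤n) (≤-reflexive (sym (*-identityˡ _)))
      exponent : N + c₁ + (ι + (t ∸ 2)) + 2 ≤ k
      exponent = begin
        N + c₁ + (ι + (t ∸ 2)) + 2
          ≡⟨ solve 4 (λ N c i s → N :+ c :+ (i :+ s) :+ con 2 := N :+ (s :+ con 2) :+ c :+ i) refl N c₁ ι (t ∸ 2) ⟩
        N + (t ∸ 2 + 2) + c₁ + ι   ≡⟨ cong (λ m → N + m + c₁ + ι) (m∸n+n≡m (≤-trans (s≤s (s≤s z≤n)) 3≤t)) ⟩
        N + t + c₁ + ι             ≤⟨ +-monoʳ-≤ (N + t + c₁) ι≤c₂ ⟩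
        N + t + c₁ + c₂            ≡⟨ partition ⟩
        k                          ∎
      aq≤bp : (j ∸ 1) * q ≤ (ι + (t ∸ 2)) * p
      aq≤bp = begin
        (j ∸ 1) * q            ≡⟨ cong (λ m → (m ∸ 1) * q) (trans (sym ι+ν≡j) (+-suc ι ν′)) ⟩
        (ι + ν′) * q           ≡⟨ *-distribʳ-+ q ι ν′ ⟩
        ι * q + ν′ * q         ≤⟨ +-mono-≤ (*-monoʳ-≤ ι q≤p) ν′q≤ ⟩
        ι * p + p * (t ∸ 2)    ≡⟨ cong (ι * p +_) (*-comm p (t ∸ 2)) ⟩
        ι * p + (t ∸ 2) * p    ≡⟨ *-distribʳ-+ p ι (t ∸ 2) ⟨
        (ι + (t ∸ 2)) * p      ∎

    isolated-case : ι ≡ j → 2 ≤ j → X ^ p * n ^ ((j ∸ 1) * q) ≤ (e ! * n ^ (k ∸ 2)) ^ p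
    isolated-case ι≡j 2≤j =
      powers-from-density {X} {e ! * n ^ (k ∸ 2)} {n} {j ∸ 1} {j ∸ 1} {p} {q} 1≤n
        (copies-density {X} {e} {j} {n} {k} {N} {c₁} {1} {c₁ ∸ 1} {j ∸ 1} 1≤n X≤ 2^c₁≤ falling≤!′ (room exponent))
        (*-monoʳ-≤ (j ∸ 1) q≤p)
      where
      j≤c₁ = subst (_≤ c₁) ι≡j ι≤c₁
      j≤c₂ = subst (_≤ c₂) ι≡j ι≤c₂
      4≤n : 4 ≤ n
      4≤n = ≤-trans (≤-trans (+-mono-≤ (≤-trans 2≤j j≤c₁) (≤-trans 2≤j j≤c₂)) c₁+c₂≤k) k≤n
      1≤n : 1 ≤ n
      1≤n = ≤-trans (s≤s z≤n) 4≤n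
      2^c₁≤ : 2 ^ c₁ ≤ 1 * n ^ (c₁ ∸ 1)
      2^c₁≤ = ≤-trans (2^≤^∸1 c₁ 4≤n (≤-trans 2≤j j≤c₁)) (≤-reflexive (sym (*-identityˡ _)))
      exponent : N + (c₁ ∸ 1) + (j ∸ 1) + 2 ≤ k
      exponent = begin
        N + (c₁ ∸ 1) + (j ∸ 1) + 2
          ≡⟨ solve 3 (λ N x y → N :+ x :+ y :+ con 2 := N :+ (x :+ con 1) :+ (y :+ con 1)) refl N (c₁ ∸ 1) (j ∸ 1) ⟩
        N + (c₁ ∸ 1 + 1) + (j ∸ 1 + 1)
          ≡⟨ cong₂ (λ x y → N + x + y) (m∸n+n≡m (≤-trans (≤-trans (s≤s z≤n) 2≤j) j≤c₁))
                                       (m∸n+n≡m (≤-trans (s≤s z≤n) 2≤j)) ⟩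
        N + c₁ + j         ≤⟨ +-monoʳ-≤ (N + c₁) j≤c₂ ⟩
        N + c₁ + c₂        ≤⟨ N+c₁+c₂≤k ⟩
        k                  ∎

    single-edge-case : ι ≡ j → j ≡ 1 → 3 ≤ e → X ^ p * n ^ ((j ∸ 1) * q) ≤ (e ! * n ^ (k ∸ 2)) ^ p
    single-edge-case ι≡j j≡1 3≤e =
      powers-from-density {X} {e ! * n ^ (k ∸ 2)} {n} {j ∸ 1} {0} {p} {q} 1≤n
        (copies-density {X} {e} {j} {n} {k} {N} {c₁} {2} {c₁ ∸ 1} {0} 1≤n X≤ (2^≤2*^∸1 c₁ 2≤n 1≤c₁) 2*falling≤
          (room exponent))
        (subst (λ m → (m ∸ 1) * q ≤ 0 * p) (sym j≡1) z≤n)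
      where
      1≤c₁ = subst (_≤ c₁) (trans ι≡j j≡1) ι≤c₁
      1≤c₂ = subst (_≤ c₂) (trans ι≡j j≡1) ι≤c₂
      2≤n : 2 ≤ n
      2≤n = ≤-trans (≤-trans (+-mono-≤ 1≤c₁ 1≤c₂) c₁+c₂≤k) k≤n
      1≤n : 1 ≤ n
      1≤n = ≤-trans (s≤s z≤n) 2≤n
      2*falling≤ : 2 * falling e j ≤ e !
      2*falling≤ = ≤-trans (≤-reflexive (cong (λ m → 2 * falling e m) j≡1))
                           (subst (λ x → 2 * x ≤ e !) (sym (*-identityʳ e)) (2*e≤e! e 3≤e))
      exponent : N + (c₁ ∸ 1) + 0 + 2 ≤ k
      exponent = begin
        N + (c₁ ∸ 1) + 0 + 2
          ≡⟨ solve 2 (λ N x → N :+ x :+ con 0 :+ con 2 := N :+ (x :+ con 1) :+ con 1) refl N (c₁ ∸ 1) ⟩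
        N + (c₁ ∸ 1 + 1) + 1   ≡⟨ cong (λ x → N + x + 1) (m∸n+n≡m 1≤c₁) ⟩
        N + c₁ + 1             ≤⟨ +-monoʳ-≤ (N + c₁) 1≤c₂ ⟩
        N + c₁ + c₂            ≤⟨ N+c₁+c₂≤k ⟩
        k                      ∎

  class-count⇒bound : ∀ {ν} → ι + ν ≡ j → (1 ≤ ν → 3 ≤ t × (ν ∸ 1) * q ≤ p * (t ∸ 2)) → 1 ≤ j → (j ≡ 1 → 3 ≤ e) →
    X ^ p * n ^ ((j ∸ 1) * q) ≤ (e ! * n ^ (k ∸ 2)) ^ p
  class-count⇒bound {suc ν′} ι+ν≡j linked _ _ = let 3≤t , ν′q≤ = linked (s≤s z≤n) in linked-case ι+ν≡j 3≤t ν′q≤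
  class-count⇒bound {zero} ι+0≡j _ 1≤j 3≤e with j ℕ.≟ 1
  ... | yes j≡1 = single-edge-case ι≡j j≡1 (3≤e j≡1)
    where ι≡j = trans (sym (+-identityʳ ι)) ι+0≡j
  ... | no j≢1 = isolated-case (trans (sym (+-identityʳ ι)) ι+0≡j) (≤∧≢⇒< 1≤j (λ 1≡j → j≢1 (sym 1≡j)))

-- Hyperedges as edge sets of copies

module _ {k n : ℕ} {H : Graph k} where

  EdgesIn : Copy n H → Copy n H → Set
  EdgesIn L L′ = ∀ (x : VElt n) → InL L (u x) (v x) → InL L′ (u x) (v x)

  SameEdges : Copy n H → Copy n H → Set
  SameEdges L L′ = EdgesIn L L′ × EdgesIn L′ L

  ≗⇒SameEdges : ∀ {L L′ : Copy n H} → f L ≗ f L′ → SameEdges L L′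
  ≗⇒SameEdges same = (λ x (a , b , ab , fa , fb) → a , b , ab , trans (sym (same a)) fa , trans (sym (same b)) fb)
                   , (λ x (a , b , ab , fa , fb) → a , b , ab , trans (same a) fa , trans (same b) fb)

module Hyperedges {k n : ℕ} (H : Graph k) (A : VertexSubset n) (w₀ : VElt n) where

  Realizes : Copy n H → VSet n → Set
  Realizes L S = ∀ x → (S x ≡ true) ⇔ (InL L (u x) (v x) × col x ≡ col w₀)

  monochromatic : ∀ {χ L} → Good H A χ L → Σ Colour (Mono χ L)
  monochromatic (inj₁ (red-copy , _)) = red , red-copy
  monochromatic (inj₂ (blue-copy , _)) = blue , blue-copy

  realization : ∀ {S} → IsHyperedge H A S → S w₀ ≡ true → Σ (Copy n H) λ L → Realizes L S
  realization (χ , L , good , S⇔) w₀∈S = L , λ x → mk⇔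
    (λ x∈S → let inL , c = Equivalence.to (S⇔ x) x∈S in inL , trans c (trans (colour inL) (sym c₀)))
    (λ (inL , c) → Equivalence.from (S⇔ x) (inL , trans c (trans c₀ (sym (colour inL)))))
    where
    mono : Σ Colour (Mono χ L)
    mono = monochromatic {χ} {L} good
    colour : ∀ {y z} → InL L y z → colourOf χ y z ≡ proj₁ mono
    colour (a , b , ab , refl , refl) = proj₂ mono a b ab
    c₀ : col w₀ ≡ proj₁ mono
    c₀ = let inL , c = Equivalence.to (S⇔ w₀) w₀∈S in trans c (colour inL)

  realizations-differ : ∀ {L L′ S S′} → Realizes L S → Realizes L′ S′ → DistinctS S S′ → ¬ SameEdges L L′
  realizations-differ {S = S} {S′} L≈S L′≈S′ (x , Sx≢S′x) (L⊆L′ , L′⊆L) =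
    Sx≢S′x (bool-ext (S x) (S′ x) to from)
    where
    bool-ext : ∀ b b′ → (b ≡ true → b′ ≡ true) → (b′ ≡ true → b ≡ true) → b ≡ b′
    bool-ext true _ to _ = sym (to refl)
    bool-ext false true _ from = from refl
    bool-ext false false _ _ = refl
    to : S x ≡ true → S′ x ≡ true
    to x∈S = let inL , c = Equivalence.to (L≈S x) x∈S in Equivalence.from (L′≈S′ x) (L⊆L′ x inL , c)
    from : S′ x ≡ true → S x ≡ true
    from x∈S′ = let inL , c = Equivalence.to (L′≈S′ x) x∈S′ in Equivalence.from (L≈S x) (L′⊆L x inL , c)

-- Graphs with at most two edges, when j = 1

module SmallGraphs {k n : ℕ} (H : Graph k) (w₀ : VElt n) where

  Rooted : Set
  Rooted = Σ (Copy n H) λ L → InL L (u w₀) (v w₀)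

  1≤n : 1 ≤ n
  1≤n = nonempty (u w₀)
    where
    nonempty : ∀ {m} → Fin m → 1 ≤ m
    nonempty {suc _} _ = s≤s z≤n

  |allFin| : length (allFin n) ≡ n
  |allFin| = length-tabulate id

  rootPair : Rooted → Fin k × Fin k
  rootPair (_ , a , b , _) = sortPair a b

  rootPair∈ : ∀ R → rootPair R ∈ pairsWith (adj H)
  rootPair∈ (L , a , b , ab , fa , fb) = ∈-pairsWith⁺ (sortPair-< a≢b) (sortPair-adj H ab)
    where
    a≢b : a ≢ b
    a≢b a≡b = u≢v w₀ (trans (sym fa) (trans (cong (f L) a≡b) fb))

  edgePair∈ : ∀ (L : Copy n H) {a b} → adj H a b ≡ true → f L a ≢ f L b →
    sortPair a b ∈ pairsWith (adj H)
  edgePair∈ L ab fa≢fb = ∈-pairsWith⁺ (sortPair-< (λ a≡b → fa≢fb (cong (f L) a≡b))) (sortPair-adj H ab)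

  through-root : ∀ ((L , a , b , _ , fa , fb) : Rooted) {x a′ b′} → f L a′ ≡ u x → f L b′ ≡ v x →
    sortPair a b ≡ sortPair a′ b′ → ends x ≡ ends w₀
  through-root (L , a , b , _ , fa , fb) {x} fa′ fb′ same with sortPair-≡⇒∈₂ same
  ... | a′∈ , b′∈ =
    two-common-ends {w = x} {w₀} (inj₁ refl) (inj₂ refl) (image a′∈ fa′) (image b′∈ fb′) (u≢v x)
    where
    image : ∀ {c z} → c ∈₂ (a , b) → f L c ≡ z → z ∈ₑ w₀
    image (inj₁ refl) refl = inj₁ fa
    image (inj₂ refl) refl = inj₂ fb

  root-edge : ∀ ((L , _) : Rooted) {x} → ends x ≡ ends w₀ → InL L (u x) (v x)
  root-edge (L , a , b , ab , fa , fb) x≡w₀ =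
    a , b , ab , trans fa (sym (cong proj₁ x≡w₀)) , trans fb (sym (cong proj₂ x≡w₀))

  pair-edge : ∀ (L : Copy n H) {c d x} → adj H c d ≡ true → sortPair (f L c) (f L d) ≡ ends x →
    InL L (u x) (v x)
  pair-edge L {c} {d} cd eq with f L c <? f L d
  ... | yes _ = c , d , cd , cong proj₁ eq , cong proj₂ eq
  ... | no _ = d , c , trans (Graph.sym H d c) cd , cong proj₁ eq , cong proj₂ eq

  image-sortPair : ∀ (L : Copy n H) {a b c d} → sortPair a b ≡ sortPair c d → c ≢ d →
    sortPair (f L a) (f L b) ≡ sortPair (f L c) (f L d)
  image-sortPair L eq c≢d with sortPair-≡⇒∈₂ eq
  ... | inj₁ refl , inj₂ refl = refl
  ... | inj₂ refl , inj₁ refl = sortPair-comm (λ e → c≢d (sym (inj L _ _ e)))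
  ... | inj₁ refl , inj₁ refl = ⊥-elim (c≢d refl)
  ... | inj₂ refl , inj₂ refl = ⊥-elim (c≢d refl)

  Distinct : List Rooted → Set
  Distinct = AllPairs (λ R R′ → ¬ SameEdges (proj₁ R) (proj₁ R′))

  count-by-key : (key : Rooted → Fin n × Fin n) → (∀ R R′ → key R ≡ key R′ → EdgesIn (proj₁ R) (proj₁ R′)) →
    ∀ cs Rs → (∀ R → key R ∈ cs) → Distinct Rs → length Rs ≤ length cs
  count-by-key key same-key cs Rs key∈ Rs! = subst (length Rs ≤_) (*-identityʳ (length cs))
    (length≤fibres (Product.≡-dec _≟_ _≟_) key 1 cs Rs (λ _ → key∈ _) fibre≤1)
    where
    fibre≤1 : ∀ {c} → c ∈ cs → length (fibre (Product.≡-dec _≟_ _≟_) key c Rs) ≤ 1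
    fibre≤1 {c} _ = pairwise-related⇒length≤1 (AllPairs.filter⁺ key≡c? Rs!)
      λ R∈ R′∈ → same-key _ _
        (trans (proj₂ (∈-filter⁻ key≡c? {xs = Rs} R∈)) (sym (proj₂ (∈-filter⁻ key≡c? {xs = Rs} R′∈))))
      where key≡c? = λ R → Product.≡-dec _≟_ _≟_ (key R) c

  one-edge-count : ∀ {h} → pairsWith (adj H) ≡ h ∷ [] → ∀ Rs → Distinct Rs → length Rs ≤ 1
  one-edge-count {h} edges≡ Rs Rs! =
    count-by-key (λ _ → ends w₀) (λ R R′ _ → all-same R R′) (ends w₀ ∷ []) Rs (λ _ → here refl) Rs!
    where
    only : ∀ {y} → y ∈ pairsWith (adj H) → y ≡ h
    only y∈ with subst (_ ∈_) edges≡ y∈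
    ... | here y≡h = y≡h
    all-same : ∀ R R′ → EdgesIn (proj₁ R) (proj₁ R′)
    all-same R@(L , _) R′ x (a′ , b′ , ab′ , fa′ , fb′) = root-edge R′ {x} (through-root R {x} fa′ fb′
      (trans (only (rootPair∈ R)) (sym (only (edgePair∈ L ab′ fa′≢fb′)))))
      where fa′≢fb′ = λ e → u≢v x (trans (sym fa′) (trans e fb′))

  module TwoEdges {h₁ h₂ : Fin k × Fin k} (edges≡ : pairsWith (adj H) ≡ h₁ ∷ h₂ ∷ []) where

    other : Fin k × Fin k → Fin k × Fin k
    other h with Product.≡-dec _≟_ _≟_ h h₁
    ... | yes _ = h₂
    ... | no _ = h₁

    other∈ : ∀ h → other h ∈ pairsWith (adj H)
    other∈ h with Product.≡-dec _≟_ _≟_ h h₁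
    ... | yes _ = subst (h₂ ∈_) (sym edges≡) (there (here refl))
    ... | no _ = subst (h₁ ∈_) (sym edges≡) (here refl)

    one-or-other : ∀ {y h} → y ∈ pairsWith (adj H) → h ∈ pairsWith (adj H) → y ≡ h ⊎ y ≡ other h
    one-or-other {y} {h} y∈ h∈ with Product.≡-dec _≟_ _≟_ h h₁ | subst (y ∈_) edges≡ y∈ | subst (h ∈_) edges≡ h∈
    ... | yes refl | here refl | _ = inj₁ refl
    ... | yes refl | there (here refl) | _ = inj₂ refl
    ... | no h≢h₁ | here refl | _ = inj₂ refl
    ... | no h≢h₁ | there (here refl) | here h≡h₁ = ⊥-elim (h≢h₁ h≡h₁)
    ... | no h≢h₁ | there (here refl) | there (here refl) = inj₁ refl

    secondPair : Rooted → Fin n × Fin n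
    secondPair (L , w₀∈L) = sortPair (f L (proj₁ o)) (f L (proj₂ o))
      where o = other (rootPair (L , w₀∈L))

    other-sorted : ∀ h → toℕ (proj₁ (other h)) < toℕ (proj₂ (other h)) ×
                         adj H (proj₁ (other h)) (proj₂ (other h)) ≡ true
    other-sorted h = ∈-pairsWith⁻ (other∈ h)

    same-second⇒EdgesIn : ∀ R R′ → secondPair R ≡ secondPair R′ → EdgesIn (proj₁ R) (proj₁ R′)
    same-second⇒EdgesIn R@(L , _) R′@(L′ , _) same x (a′ , b′ , ab′ , fa′ , fb′)
      with one-or-other (edgePair∈ L ab′ (λ e → u≢v x (trans (sym fa′) (trans e fb′)))) (rootPair∈ R)
    ... | inj₁ y≡root = root-edge R′ {x} (through-root R {x} fa′ fb′ (sym y≡root))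
    ... | inj₂ y≡other =
      pair-edge L′ {x = x} (proj₂ (other-sorted (rootPair R′))) (trans (sym same) (sym x≡second))
      where
      o = other (rootPair R)
      o₁<o₂ = proj₁ (other-sorted (rootPair R))
      x≡second : ends x ≡ secondPair R
      x≡second = begin
        ends x                               ≡⟨ sortPair-sorted (u<v x) ⟨
        sortPair (u x) (v x)                 ≡⟨ cong₂ sortPair fa′ fb′ ⟨
        sortPair (f L a′) (f L b′)           ≡⟨ image-sortPair L {a′} {b′}
                                                  (trans y≡other (sym (sortPair-sorted o₁<o₂)))
                                                  (λ e → <-irrefl (cong toℕ e) o₁<o₂) ⟩
        secondPair R                         ∎
        where open ≡-Reasoning

    meeting-root : List (Fin n × Fin n)
    meeting-root = map (sortPair (u w₀)) (allFin n) ++ map (sortPair (v w₀)) (allFin n)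

    second∈meeting-root : k < 4 → ∀ R → secondPair R ∈ meeting-root
    second∈meeting-root k<4 (L , a , b , ab , fa , fb) =
      [ meets {o₁} {o₂}
      , (λ o₂∈ → subst (_∈ meeting-root) (sortPair-comm (λ e → o₁≢o₂ (inj L _ _ (sym e))))
                       (meets {o₂} {o₁} o₂∈))
      ]′
        (two-edges-in-three-vertices k<4 a b o₁ o₂ a≢b o₁≢o₂)
      where
      o₁ = proj₁ (other (sortPair a b))
      o₂ = proj₂ (other (sortPair a b))
      o₁≢o₂ : o₁ ≢ o₂
      o₁≢o₂ e = <-irrefl (cong toℕ e) (proj₁ (other-sorted (sortPair a b)))
      a≢b : a ≢ b
      a≢b a≡b = u≢v w₀ (trans (sym fa) (trans (cong (f L) a≡b) fb))
      meets : ∀ {c d} → c ∈₂ (a , b) → sortPair (f L c) (f L d) ∈ meeting-root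
      meets {d = d} (inj₁ refl) = subst (λ z → sortPair z (f L d) ∈ meeting-root) (sym fa)
                                    (∈-++⁺ˡ (∈-map⁺ (sortPair (u w₀)) (∈-allFin (f L d))))
      meets {d = d} (inj₂ refl) = subst (λ z → sortPair z (f L d) ∈ meeting-root) (sym fb)
                                    (∈-++⁺ʳ _ (∈-map⁺ (sortPair (v w₀)) (∈-allFin (f L d))))

    two-edge-count : 3 ≤ k → ∀ Rs → Distinct Rs → length Rs ≤ 2 * n ^ (k ∸ 2)
    two-edge-count 3≤k Rs Rs! with k ℕ.≟ 3
    ... | yes k≡3 = ≤-trans (count-by-key secondPair same-second⇒EdgesIn meeting-root Rs
                               (second∈meeting-root (subst (_< 4) (sym k≡3) ≤-refl)) Rs!)
                             (≤-reflexive meeting-length)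
      where
      meeting-length : length meeting-root ≡ 2 * n ^ (k ∸ 2)
      meeting-length = begin
        length meeting-root        ≡⟨ length-++ (map (sortPair (u w₀)) (allFin n)) ⟩
        length (map (sortPair (u w₀)) (allFin n)) + length (map (sortPair (v w₀)) (allFin n))
                                   ≡⟨ cong₂ _+_ (trans (length-map _ (allFin n)) |allFin|)
                                                (trans (length-map _ (allFin n)) |allFin|) ⟩
        n + n                      ≡⟨ solve 1 (λ n → n :+ n := con 2 :* (n :* con 1)) refl n ⟩
        2 * n ^ 1                  ≡⟨ cong (λ m → 2 * n ^ (m ∸ 2)) k≡3 ⟨
        2 * n ^ (k ∸ 2)            ∎
        where open ≡-Reasoning
    ... | no k≢3 =
      ≤-trans (count-by-key secondPair same-second⇒EdgesIn (cartesianProduct (allFin n) (allFin n)) Rs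
                 (λ _ → ∈-cartesianProduct⁺ (∈-allFin _) (∈-allFin _)) Rs!)
              pairs-bound
      where
      4≤k : 4 ≤ k
      4≤k = ≤∧≢⇒< 3≤k (λ 3≡k → k≢3 (sym 3≡k))
      pairs-bound : length (cartesianProduct (allFin n) (allFin n)) ≤ 2 * n ^ (k ∸ 2)
      pairs-bound = begin
        length (cartesianProduct (allFin n) (allFin n))   ≡⟨ length-cartesianProduct (allFin n) (allFin n) ⟩
        length (allFin n) * length (allFin n)             ≡⟨ cong₂ _*_ |allFin| |allFin| ⟩
        n * n                                             ≡⟨ cong (n *_) (*-identityʳ n) ⟨
        n ^ 2                                             ≤⟨ ^-monoʳ-≤ n {{>-nonZero 1≤n}} (m+n≤o⇒m≤o∸n 2 4≤k) ⟩
        n ^ (k ∸ 2)                                       ≤⟨ m≤m+n (n ^ (k ∸ 2)) _ ⟩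
        2 * n ^ (k ∸ 2)                                   ∎
        where open ≤-Reasoning

  few-edges-count : eH H ≤ 2 → ∀ Rs → Distinct Rs → length Rs ≤ eH H ! * n ^ (k ∸ 2)
  few-edges-count e≤2 Rs Rs! with pairsWith (adj H) in edges≡ | length-pairsWith (adj H)
  ... | [] | _ with Rs
  ...   | [] = z≤n
  ...   | R ∷ _ with subst (rootPair R ∈_) edges≡ (rootPair∈ R)
  ...     | ()
  few-edges-count e≤2 Rs Rs! | h ∷ [] | 1≡e = subst (λ e → length Rs ≤ e ! * n ^ (k ∸ 2)) 1≡e
    (≤-trans (one-edge-count edges≡ Rs Rs!)
             (subst (1 ≤_) (sym (*-identityˡ _)) (m^n>0 n {{>-nonZero 1≤n}} (k ∸ 2))))
  few-edges-count e≤2 Rs Rs! | h₁ ∷ h₂ ∷ [] | 2≡e = subst (λ e → length Rs ≤ e ! * n ^ (k ∸ 2)) 2≡e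
    (TwoEdges.two-edge-count edges≡ 3≤k Rs Rs!)
    where
    3≤k : 3 ≤ k
    3≤k with k ℕ.≤? 2
    ... | yes k≤2 = contradiction (≤-trans (≤-reflexive 2≡e) (eH≤1 k≤2 H)) λ { (s≤s ()) }
    ... | no k≰2 = ≰⇒> k≰2
  few-edges-count e≤2 Rs Rs! | _ ∷ _ ∷ _ ∷ _ | 3+≡e =
    contradiction (≤-trans (≤-reflexive 3+≡e) e≤2) λ { (s≤s (s≤s ())) }

module _ {k n : ℕ} (H : Graph k) (U : List (VElt n)) {p q : ℕ} (m₂ : IsMaxM2One H p q)
         (U! : Covering.DistinctEnds H U U) (1≤j : 1 ≤ length U) (3≤e : length U ≡ 1 → 3 ≤ eH H) where
  open Covering H U

  class-bound : ∀ E₀ {X} → X ≤ falling (eH H) (length U) * (n ^ Class.#_ E₀ outside * 2 ^ Class.#_ E₀ low) →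
    X ^ p * n ^ ((length U ∸ 1) * q) ≤ (eH H ! * n ^ (k ∸ 2)) ^ p
  class-bound E₀ X≤ = class-count⇒bound X≤ partition ι≤#low ι≤#high (proj₁ (proj₂ m₂))
    (Fin.injective⇒≤ (λ {a} {b} → inj (proj₁ E₀) a b)) ι+ν≡|U| linked 1≤j 3≤e
    where
    open Class E₀
    open Bounds U!
    partition : # outside + # inner + # low + # high ≡ k
    partition = trans (kinds-partition kind (allFin k)) (length-tabulate id)
    linked : 1 ≤ ν → 3 ≤ # inner × (ν ∸ 1) * q ≤ p * (# inner ∸ 2)
    linked 1≤ν = 3≤#inner 1≤ν ,
      ≤-trans (*-monoˡ-≤ q (∸-monoˡ-≤ 1 ν≤eF)) (proj₁ (proj₂ (proj₂ m₂)) innerSubgraph (3≤#inner 1≤ν))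

  covering-copies-bound : ∀ E Es → AllPairs (λ E E′ → ¬ f (proj₁ E) ≗ f (proj₁ E′)) (E ∷ Es) →
    length (E ∷ Es) ^ p * n ^ ((length U ∸ 1) * q) ≤ (eH H ! * n ^ (k ∸ 2)) ^ p
  covering-copies-bound E Es Es! = let E₀ , total = copies-by-class U! E Es Es! in class-bound E₀ total

module Families {k n : ℕ} (H : Graph k) (A : VertexSubset n) (w₀ : VElt n) (U′ : List (VElt n)) where

  U = w₀ ∷ U′
  open Hyperedges H A w₀
  open Covering H U

  Contains : VSet n → Set
  Contains S = All (λ x → S x ≡ true) U

  Member : Set
  Member = ∃ λ S → IsHyperedge H A S × Contains S

  realizationOf : (m : Member) → Σ (Copy n H) λ L → Realizes L (proj₁ m)
  realizationOf (_ , h , S∋w₀ ∷ _) = realization h S∋w₀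

  covering : Member → CoveringCopy
  covering m@(_ , _ , S∋U) = L , All.map (λ {x} Sx → proj₁ (Equivalence.to (L≈S x) Sx)) S∋U
    where L = proj₁ (realizationOf m); L≈S = proj₂ (realizationOf m)

  coverings-differ : ∀ {m m′} → DistinctS (proj₁ m) (proj₁ m′) → ¬ SameEdges (proj₁ (covering m)) (proj₁ (covering m′))
  coverings-differ {m} {m′} = realizations-differ {proj₁ (realizationOf m)} {proj₁ (realizationOf m′)}
                                                  (proj₂ (realizationOf m)) (proj₂ (realizationOf m′))

  distinct-ends : Member → AllPairs DistinctV U → DistinctEnds U
  distinct-ends m@(_ , _ , S∋U) U! = subst DistinctEnds (map-id U)
    (AllPairs-map-on {P = λ x → col x ≡ col w₀} {R = DistinctV} {S = λ w w′ → ends w ≢ ends w′} id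
      (λ {x} {y} → different-ends {x} {y}) same-colour U!)
    where
    same-colour : All (λ x → col x ≡ col w₀) U
    same-colour = All.map (λ {x} Sx → proj₂ (Equivalence.to (proj₂ (realizationOf m) x) Sx)) S∋U
    different-ends : ∀ {x y} → col x ≡ col w₀ → col y ≡ col w₀ → DistinctV x y → ends x ≢ ends y
    different-ends cx cy x≢y same = x≢y (cong proj₁ same , cong proj₂ same , trans cx (sym cy))

  members : ∀ {Ss} → All (IsHyperedge H A) Ss → All Contains Ss → List Member
  members hs ss = All.toList (All.zip (hs , ss))

  length-coverings : ∀ {Ss} (hs : All (IsHyperedge H A) Ss) ss → length (map covering (members hs ss)) ≡ length Ss
  length-coverings hs ss = trans (length-map covering (members hs ss))
    (trans (sym (length-map proj₁ (members hs ss))) (cong length (map-proj₁-toList (All.zip (hs , ss)))))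

  coverings-distinct : ∀ {Ss} (hs : All (IsHyperedge H A) Ss) ss → AllPairs DistinctS Ss →
    AllPairs (λ E E′ → ¬ SameEdges (proj₁ E) (proj₁ E′)) (map covering (members hs ss))
  coverings-distinct hs ss Ss! = AllPairs.map⁺ (AP.map (λ {m} {m′} → coverings-differ {m} {m′})
    (AllPairs.map⁻ (subst (AllPairs DistinctS) (sym (map-proj₁-toList (All.zip (hs , ss)))) Ss!)))

  general-bound : ∀ {S Ss p q} (hs : All (IsHyperedge H A) (S ∷ Ss)) (ss : All Contains (S ∷ Ss)) →
    AllPairs DistinctS (S ∷ Ss) → AllPairs DistinctV U → IsMaxM2One H p q → (length U ≡ 1 → 3 ≤ eH H) →
    length (S ∷ Ss) ^ p * n ^ ((length U ∸ 1) * q) ≤ (eH H ! * n ^ (k ∸ 2)) ^ p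
  general-bound {p = p} {q} hs@(h ∷ _) ss@(s ∷ _) Ss! U! m₂ 3≤e =
    subst (λ m → m ^ p * n ^ ((length U ∸ 1) * q) ≤ (eH H ! * n ^ (k ∸ 2)) ^ p) (length-coverings hs ss)
      (covering-copies-bound H U m₂ (distinct-ends (_ , h , s) U!) (s≤s z≤n) 3≤e _ _
        (AP.map (λ {E} {E′} ¬same same → ¬same (≗⇒SameEdges {L = proj₁ E} {proj₁ E′} same))
          (coverings-distinct hs ss Ss!)))

  small-bound : ∀ {Ss} → eH H ≤ 2 → (hs : All (IsHyperedge H A) Ss) (ss : All Contains Ss) → AllPairs DistinctS Ss →
    length Ss ≤ eH H ! * n ^ (k ∸ 2)
  small-bound e≤2 hs ss Ss! = subst (_≤ _) (trans (length-map root Es) (length-coverings hs ss))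
    (SmallGraphs.few-edges-count H w₀ e≤2 (map root Es) (AllPairs.map⁺ (coverings-distinct hs ss Ss!)))
    where
    Es = map covering (members hs ss)
    root : CoveringCopy → SmallGraphs.Rooted H w₀
    root (L , c) = L , All.head c

lemma5p4 : ∀ {k} (H : Graph k) (n : ℕ) (A : VertexSubset n) →
    count A ≡ count (λ x → not (A x)) →
    ∀ (p q : ℕ) → IsMaxM2One H p q →
    ∀ (j : ℕ) → 1 ≤ j → j ≤ eH H →
    ∀ (U : List (VElt n)) → IsJSet j U →
    ∀ (Ss : List (VSet n)) →
    All (IsHyperedge H A) Ss →
    All (λ S → All (λ x → S x ≡ true) U) Ss →
    AllPairs DistinctS Ss →
    length Ss ^ p * n ^ ((j ∸ 1) * q) ≤ (eH H ! * n ^ (k ∸ 2)) ^ p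
lemma5p4 {k} H n A _ p q m₂ j _ _ U _ [] _ _ _ = empty-family (≤-trans (proj₁ m₂) (proj₁ (proj₂ m₂)))
  where
  empty-family : ∀ {p} → 1 ≤ p → 0 ^ p * n ^ ((j ∸ 1) * q) ≤ (eH H ! * n ^ (k ∸ 2)) ^ p
  empty-family {suc _} _ = z≤n
lemma5p4 H n A _ p q m₂ j 1≤j _ [] (refl , _) (_ ∷ _) _ _ _ = contradiction 1≤j λ ()
lemma5p4 {k} H n A _ p q m₂ _ _ _ (w₀ ∷ []) (refl , U!) Ss@(_ ∷ _) hs ss Ss! with 3 ≤? eH H
... | yes 3≤e = Families.general-bound H A w₀ [] hs ss Ss! U! m₂ (λ _ → 3≤e)
... | no 3≰e = single-power (Families.small-bound H A w₀ [] (≤-pred (≰⇒> 3≰e)) hs ss Ss!)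
  where
  single-power : ∀ {X Y} → X ≤ Y → X ^ p * n ^ (0 * q) ≤ Y ^ p
  single-power X≤Y = ≤-trans (≤-reflexive (*-identityʳ _)) (^-monoˡ-≤ p X≤Y)
lemma5p4 H n A _ p q m₂ _ _ _ (w₀ ∷ w₁ ∷ U′) (refl , U!) Ss@(_ ∷ _) hs ss Ss! =
  Families.general-bound H A w₀ (w₁ ∷ U′) hs ss Ss! U! m₂ λ ()
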